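{- For integers $n\ge k\ge 1$ and $m\ge 0$, let $D(n,k,m)$ be the number of partitions of $n$ into $k$ distinct parts which have exactly $m$ sequences of odd length. Let $A_1(n,k,m)$ be the number of partitions $\lambda$ of $n$ into odd parts such that $\mathrm{Dur}_2(\lambda)=k$, $\lambda$ is of type I, and $\mathrm{dur}_2(\lambda)=m$; and let $A_2(n,k,m)$ be the number of partitions $\lambda$ of $n$ into odd parts such that $\mathrm{Dur}_2(\lambda)=k$, $\lambda$ is of type II, and $\mathrm{dur}_2(\lambda)=m$. Then \[ A_1(n,k,m)=D(n,2k,2m),\qquad A_2(n,k,m)=D(n,2k-1,2m+1). \]
   Context: For a partition into distinct parts, a "sequence" is a maximal run of parts forming consecutive integers (e.g. $7+6+5+2+1$ has sequences $(7,6,5)$ and $(2,1)$); its length is the number of parts in it. For a partition $\lambda=(\lambda_1\ge\lambda_2\ge\cdots\ge\lambda_\ell)$ into odd parts, set $\lambda_i=0$ for $i>\ell$. Its 2-modular Durfee side is $\mathrm{Dur}_2(\lambda)=\max\{i\ge 1:\lambda_i\ge 2i-1\}$ (and $0$ if $\lambda$ is empty); equivalently, it is the side of the largest square fitting in the 2-modular Ferrers diagram of $\lambda$, in which a part $2a+1$ is a row of $a+1$ cells. If $k=\mathrm{Dur}_2(\lambda)\ge1$, $\lambda$ is of type I if $\lambda_k>2k-1$ and of type II if $\lambda_k=2k-1$. The 2-modular sub-Durfee side $\mathrm{dur}_2(\lambda)$ is defined as follows: if $\lambda$ is of type I, $\mathrm{dur}_2(\lambda)$ is the largest $m\ge 0$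 such that $m=0$ or $\lambda_{k+m}\ge 2m-1$ (the 2-modular Durfee side of the partition $(\lambda_{k+1},\lambda_{k+2},\dots)$ below the Durfee square); if $\lambda$ is of type II, $\mathrm{dur}_2(\lambda)$ is the largest $j\ge0$ such that $j=0$ or $\lambda_{k+j}\ge 2j+1$ (i.e. the largest $j$ such that a $j$ (rows) by $j+1$ (columns) rectangle fits into the 2-modular diagram of $(\lambda_{k+1},\lambda_{k+2},\dots)$, and $0$ if none). -}

module Defs where

open import Data.Nat using (ℕ; zero; suc; _+_; _*_; _∸_; _≤_; _<_; _>_; _≥_; _≡ᵇ_)
open import Data.Nat.Properties using (_≟_)
open import Data.Nat.DivMod using (_%_)
open import Data.List using (List; []; _∷_; length; filter)
open import Data.Nat.ListAction using (sum)
open import Data.Sum using (_⊎_)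
open import Data.Product using (proj₁)
open import Relation.Binary.Bundles using (Setoid)
open import Relation.Binary.PropositionalEquality using (setoid)
import Relation.Binary.Construct.On as On
open import Data.List.Relation.Unary.All using (All)
open import Data.List.Relation.Unary.Linked using (Linked)
open import Data.Bool using (if_then_else_)
open import Data.Product using (Σ; _×_)
open import Relation.Binary.PropositionalEquality using (_≡_)

-- A partition is represented by the list of its parts in (weakly) decreasing order.

IsDistinctPartition : ℕ → List ℕ → Set
IsDistinctPartition n l = Linked _>_ l × All (λ x → 1 ≤ x) l × sum l ≡ n

IsOddPartition : ℕ → List ℕ → Set
IsOddPartition n l = Linked _≥_ l × All (λ x → x % 2 ≡ 1) l × sum l ≡ n

-- Lengths of the sequences (maximal runs of consecutive integers) of a
-- strictly decreasing list.  go p c xs : p = previous part, c = length of the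
-- current run so far.
runsGo : ℕ → ℕ → List ℕ → List ℕ
runsGo p c [] = c ∷ []
runsGo p c (x ∷ xs) = if suc x ≡ᵇ p then runsGo x (suc c) xs else (c ∷ runsGo x 1 xs)

runLengths : List ℕ → List ℕ
runLengths [] = []
runLengths (x ∷ xs) = runsGo x 1 xs

oddSeqCount : List ℕ → ℕ
oddSeqCount l = length (filter (λ c → c % 2 ≟ 1) (runLengths l))

lookup0 : List ℕ → ℕ → ℕ
lookup0 [] _ = 0
lookup0 (x ∷ xs) zero = x
lookup0 (x ∷ xs) (suc i) = lookup0 xs i

-- λ_i, 1-indexed, with λ_i = 0 for i > ℓ (part l 0 = λ_1 is never used meaningfully)
part : List ℕ → ℕ → ℕ
part l i = lookup0 l (i ∸ 1)

-- Dur₂(λ) = k : k = max{ i ≥ 1 : λ_i ≥ 2i-1 } (0 if that set is empty).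
-- (For k = 0 the first component 0 ≤ λ_0 is vacuous.)
IsDur2 : List ℕ → ℕ → Set
IsDur2 l k = (2 * k ∸ 1 ≤ part l k) × (∀ i → k < i → part l i < 2 * i ∸ 1)

TypeI : List ℕ → ℕ → Set
TypeI l k = part l k > 2 * k ∸ 1

TypeII : List ℕ → ℕ → Set
TypeII l k = part l k ≡ 2 * k ∸ 1

-- dur₂ for type I (with Dur₂ = k): largest m ≥ 0 with m = 0 or λ_{k+m} ≥ 2m-1.
IsSubDurI : List ℕ → ℕ → ℕ → Set
IsSubDurI l k m = (m ≡ 0 ⊎ 2 * m ∸ 1 ≤ part l (k + m))
                × (∀ j → m < j → part l (k + j) < 2 * j ∸ 1)

-- dur₂ for type II (with Dur₂ = k): largest j ≥ 0 with j = 0 or λ_{k+j} ≥ 2j+1.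
IsSubDurII : List ℕ → ℕ → ℕ → Set
IsSubDurII l k m = (m ≡ 0 ⊎ 2 * m + 1 ≤ part l (k + m))
                 × (∀ j → m < j → part l (k + j) < 2 * j + 1)

DSet : ℕ → ℕ → ℕ → Set
DSet n k m = Σ (List ℕ) λ l → IsDistinctPartition n l × length l ≡ k × oddSeqCount l ≡ m

A1Set : ℕ → ℕ → ℕ → Set
A1Set n k m = Σ (List ℕ) λ l → IsOddPartition n l × IsDur2 l k × TypeI l k × IsSubDurI l k m

A2Set : ℕ → ℕ → ℕ → Set
A2Set n k m = Σ (List ℕ) λ l → IsOddPartition n l × IsDur2 l k × TypeII l k × IsSubDurII l k m

-- Each set viewed as a setoid in which two elements are equal iff they are
-- the same partition (the remaining components are mere proofs).
-- A bijection between such setoids expresses equality of the counts.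
DSetoid : ℕ → ℕ → ℕ → Setoid _ _
DSetoid n k m = On.setoid (setoid (List ℕ)) (proj₁ {B = λ l → IsDistinctPartition n l × length l ≡ k × oddSeqCount l ≡ m})

A1Setoid : ℕ → ℕ → ℕ → Setoid _ _
A1Setoid n k m = On.setoid (setoid (List ℕ)) (proj₁ {B = λ l → IsOddPartition n l × IsDur2 l k × TypeI l k × IsSubDurI l k m})

A2Setoid : ℕ → ℕ → ℕ → Setoid _ _
A2Setoid n k m = On.setoid (setoid (List ℕ)) (proj₁ {B = λ l → IsOddPartition n l × IsDur2 l k × TypeII l k × IsSubDurII l k m})

-- Halve the parts of an odd partition, λᵢ = 2aᵢ + 1. In type I the 2-modular Durfee square
-- (side k) and the sub-Durfee square (side m) cut a into k parts ≥ k, then m parts in [m − 1, k),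
-- then a partition Γ with parts < m; removing the squares leaves a partition r with k parts and
-- a partition x with m parts ≤ k − m. In type II the k-th half is k − 1; dropping it gives the
-- same picture with k − 1 for k, the m × (m + 1) rectangle giving parts ≥ m and Γ parts ≤ m.
-- Reading x as a lattice path, a q-binomial shuffle trades (r, x) for partitions τ and β with
-- m and k − m parts of the same total. On the other side, removing the staircase from a
-- partition into distinct parts turns its sequences into blocks of equal parts; pairing off
-- equal parts splits it into two copies of β + 1 and a strict partition S with one part per
-- sequence of odd length, and the gaps of S interleave the multiplicities of Γ (odd positions)
-- with the gaps of τ (even positions). Every step changes the size by an explicit amount, and
-- the amounts agree.

module Submission where

open import Defs
open import Data.Nat using (ℕ; zero; suc; pred; _+_; _*_; _∸_; _≤_; _<_; _≥_; _>_; z≤n; s≤s; _≡ᵇ_; ⌊_/2⌋)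
open import Data.Nat.Properties
open import Data.Nat.DivMod using (_%_; [m+n]%n≡m%n; [m+kn]%n≡m%n)
open import Data.Nat.ListAction using (sum)
open import Data.Nat.ListAction.Properties using (sum-++; sum-↭)
open import Data.Nat.Solver using (module +-*-Solver)
open import Data.List using (List; []; _∷_; _++_; length; map; filter; replicate; merge; take; drop)
open import Data.List.Properties
  using (length-++; length-map; length-replicate; map-∘; map-id; map-id-local; map-++; ++-assoc; take++drop≡id; drop-drop; drop-map; length-take; take-take; filter-accept; filter-reject)
open import Data.List.Relation.Unary.All as All using (All; []; _∷_)
import Data.List.Relation.Unary.All.Properties as All
open import Data.List.Relation.Unary.Linked as Linked using (Linked; []; [-]; _∷_)
import Data.List.Relation.Unary.Linked.Properties as Linked
open import Data.List.Relation.Unary.Sorted.TotalOrder.Properties using (merge⁺)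
open import Data.List.Relation.Binary.Permutation.Propositional using (↭-sym)
open import Data.List.Relation.Binary.Permutation.Propositional.Properties using (merge-↭; ↭-length; All-resp-↭)
open import Data.Product as Prod using (∃; _×_; _,_; proj₁; proj₂; uncurry)
open import Data.Sum using (_⊎_; inj₁; inj₂)
open import Data.Bool using (true; false; if_then_else_)
open import Data.Empty using (⊥-elim)
open import Function using (_∘_)
open import Function.Bundles using (Inverse)
open import Function.Construct.Composition using () renaming (inverse to _⨾_)
open import Relation.Binary.Bundles using (Setoid)
open import Relation.Binary.PropositionalEquality
import Relation.Binary.Construct.On as On
import Relation.Binary.Construct.Flip.EqAndOrd as Flip
open import Relation.Nullary using (yes; no; ¬_; does)
open import Relation.Nullary.Decidable using (dec-true; dec-false)
open +-*-Solver using (solve; _:+_; _:*_; _:=_; con)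
open ≡-Reasoning

Subset : {A : Set} → (A → Set) → Setoid _ _
Subset {A} P = On.setoid (setoid A) (proj₁ {B = P})

record SubsetInverse {A B : Set} (P : A → Set) (Q : B → Set) : Set where
  field
    to      : A → B
    from    : B → A
    to-∈    : ∀ {a} → P a → Q (to a)
    from-∈  : ∀ {b} → Q b → P (from b)
    from∘to : ∀ {a} → P a → from (to a) ≡ a
    to∘from : ∀ {b} → Q b → to (from b) ≡ b

  inverse : Inverse (Subset P) (Subset Q)
  inverse = record
    { to        = Prod.map to to-∈
    ; from      = Prod.map from from-∈
    ; to-cong   = cong to
    ; from-cong = cong from
    ; inverse   = (λ {b} eq → trans (cong to eq) (to∘from (proj₂ b)))
                , (λ {a} eq → trans (cong from eq) (from∘to (proj₂ a)))
    }

≥-head : ∀ {x l} → Linked _≥_ (x ∷ l) → All (_≤ x) l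
≥-head [-] = []
≥-head (y≤x ∷ lk) = y≤x ∷ All.map (λ z≤y → ≤-trans z≤y y≤x) (≥-head lk)

≥-cons : ∀ {x l} → All (_≤ x) l → Linked _≥_ l → Linked _≥_ (x ∷ l)
≥-cons [] _ = [-]
≥-cons (y≤x ∷ _) lk = y≤x ∷ lk

≥-raise : ∀ {x y l} → x ≤ y → Linked _≥_ (x ∷ l) → Linked _≥_ (y ∷ l)
≥-raise _ [-] = [-]
≥-raise x≤y (z≤x ∷ lk) = ≤-trans z≤x x≤y ∷ lk

>-head : ∀ {x l} → Linked _>_ (x ∷ l) → All (_< x) l
>-head [-] = []
>-head (y<x ∷ lk) = y<x ∷ All.map (λ z<y → <-trans z<y y<x) (>-head lk)

>-cons : ∀ {x l} → All (_< x) l → Linked _>_ l → Linked _>_ (x ∷ l)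
>-cons [] _ = [-]
>-cons (y<x ∷ _) lk = y<x ∷ lk

sorted-upper-bound : ∀ {l} → Linked _≥_ l → ∃ λ c → Linked _≥_ (c ∷ l)
sorted-upper-bound {[]} _ = 0 , [-]
sorted-upper-bound {x ∷ _} lk = x , ≤-refl ∷ lk

sorted-++ : ∀ {c} P Q → Linked _≥_ P → Linked _≥_ Q → All (c ≤_) P → All (_≤ c) Q → Linked _≥_ (P ++ Q)
sorted-++ [] Q _ lQ _ _ = lQ
sorted-++ (x ∷ []) [] _ _ _ _ = [-]
sorted-++ (x ∷ []) (y ∷ Q) _ lQ (c≤x ∷ _) (y≤c ∷ _) = ≤-trans y≤c c≤x ∷ lQ
sorted-++ (x ∷ x′ ∷ P) Q (x′≤x ∷ lP) lQ (_ ∷ c≤P) Q≤c = x′≤x ∷ sorted-++ (x′ ∷ P) Q lP lQ c≤P Q≤c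

replicate-sorted : ∀ c x → Linked _≥_ (replicate c x)
replicate-sorted zero x = []
replicate-sorted (suc zero) x = [-]
replicate-sorted (suc (suc c)) x = ≤-refl ∷ replicate-sorted (suc c) x

sorted-take : ∀ {a} d → Linked _≥_ a → Linked _≥_ (take d a)
sorted-take zero _ = []
sorted-take {[]} (suc d) _ = []
sorted-take {x ∷ []} (suc zero) _ = [-]
sorted-take {x ∷ []} (suc (suc d)) _ = [-]
sorted-take {x ∷ y ∷ a} (suc zero) _ = [-]
sorted-take {x ∷ y ∷ a} (suc (suc d)) (y≤x ∷ lk) = y≤x ∷ sorted-take (suc d) lk

sorted-drop : ∀ {a} d → Linked _≥_ a → Linked _≥_ (drop d a)
sorted-drop zero lk = lk
sorted-drop {[]} (suc d) _ = []
sorted-drop {x ∷ a} (suc d) lk = sorted-drop d (Linked.tail lk)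

take-++ : ∀ {d} (P Q : List ℕ) → length P ≡ d → take d (P ++ Q) ≡ P
take-++ [] Q refl = refl
take-++ (p ∷ P) Q refl = cong (p ∷_) (take-++ P Q refl)

drop-++ : ∀ {d} (P Q : List ℕ) → length P ≡ d → drop d (P ++ Q) ≡ Q
drop-++ [] Q refl = refl
drop-++ (p ∷ P) Q refl = drop-++ P Q refl

drop-++-∷ : ∀ {d} (P : List ℕ) y Q → length P ≡ d → drop (suc d) (P ++ y ∷ Q) ≡ Q
drop-++-∷ [] y Q refl = refl
drop-++-∷ (p ∷ P) y Q refl = drop-++-∷ P y Q refl

length-take-≤ : ∀ {d} (a : List ℕ) → d ≤ length a → length (take d a) ≡ d
length-take-≤ {d} a d≤a = trans (length-take d a) (m≤n⇒m⊓n≡m d≤a)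

drop-lookup : ∀ (a : List ℕ) {i} → i < length a → drop i a ≡ lookup0 a i ∷ drop (suc i) a
drop-lookup (x ∷ a) {zero} _ = refl
drop-lookup (x ∷ a) {suc i} (s≤s i<a) = drop-lookup a i<a

map-+∸ : ∀ c {l} → All (c ≤_) l → map (_+ c) (map (_∸ c) l) ≡ l
map-+∸ c {l} c≤l = trans (sym (map-∘ l)) (map-id-local (All.map m∸n+n≡m c≤l))

map-∸+ : ∀ c l → map (_∸ c) (map (_+ c) l) ≡ l
map-∸+ c l = trans (sym (map-∘ l)) (map-id-local (All.universal (λ y → m+n∸n≡m y c) l))

map-pred∘map-suc : ∀ l → map pred (map suc l) ≡ l
map-pred∘map-suc l = trans (sym (map-∘ l)) (map-id l)

map-suc∘map-pred : ∀ {l} → All (1 ≤_) l → map suc (map pred l) ≡ l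
map-suc∘map-pred {l} pos = trans (sym (map-∘ l)) (map-id-local (All.map (λ { (s≤s _) → refl }) pos))

sum-map-suc : ∀ l → sum (map suc l) ≡ sum l + length l
sum-map-suc [] = refl
sum-map-suc (x ∷ l) = trans (cong (suc x +_) (sum-map-suc l))
  (solve 3 (λ x s n → con 1 :+ x :+ (s :+ n) := x :+ s :+ (con 1 :+ n)) refl x (sum l) (length l))

sum-map-+ : ∀ c l → sum (map (_+ c) l) ≡ sum l + length l * c
sum-map-+ c [] = refl
sum-map-+ c (x ∷ l) rewrite sum-map-+ c l =
  solve 4 (λ x c s n → x :+ c :+ (s :+ n :* c) := x :+ s :+ (c :+ n :* c)) refl x c (sum l) (length l)

-- The q-binomial shuffle

-- x is a lattice path in a j × m box (the heights of its m steps). Walking down r, a part goes to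
-- τ, raised by the current height, when x steps at that height, and to β otherwise. This is the
-- bijection behind 1 / (q)_{j+m} · [j+m choose m]_q = 1 / ((q)_m (q)_j).
unshuffle : ℕ → List ℕ → List ℕ → List ℕ × List ℕ
unshuffle j r [] = [] , r
unshuffle j [] (_ ∷ _) = [] , []
unshuffle j (g ∷ r) (y ∷ x) =
  if does (y ≟ j)
  then Prod.map₁ (g + j ∷_) (unshuffle j r x)
  else Prod.map₂ (g ∷_) (unshuffle (pred j) r (y ∷ x))

shuffle : List ℕ → List ℕ → List ℕ × List ℕ
shuffle [] β = β , []
shuffle (t ∷ τ) [] = Prod.map (t ∷_) (0 ∷_) (shuffle τ [])
shuffle (t ∷ τ) (b ∷ β) =
  if does (b + length (b ∷ β) ≤? t)
  then Prod.map (t ∸ length (b ∷ β) ∷_) (length (b ∷ β) ∷_) (shuffle τ (b ∷ β))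
  else Prod.map₁ (b ∷_) (shuffle (t ∷ τ) β)

unshuffle-hit : ∀ j g r x → unshuffle j (g ∷ r) (j ∷ x) ≡ Prod.map₁ (g + j ∷_) (unshuffle j r x)
unshuffle-hit j g r x rewrite dec-true (j ≟ j) refl = refl

unshuffle-miss : ∀ {j y} g r x → y ≢ j → unshuffle j (g ∷ r) (y ∷ x) ≡ Prod.map₂ (g ∷_) (unshuffle (pred j) r (y ∷ x))
unshuffle-miss {j} {y} g r x y≢j rewrite dec-false (y ≟ j) y≢j = refl

module _ {t b : ℕ} {τ β : List ℕ} where

  shuffle-take-τ : b + length (b ∷ β) ≤ t →
    shuffle (t ∷ τ) (b ∷ β) ≡ Prod.map (t ∸ length (b ∷ β) ∷_) (length (b ∷ β) ∷_) (shuffle τ (b ∷ β))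
  shuffle-take-τ b+L≤t rewrite dec-true (b + length (b ∷ β) ≤? t) b+L≤t = refl

  shuffle-take-β : ¬ b + length (b ∷ β) ≤ t → shuffle (t ∷ τ) (b ∷ β) ≡ Prod.map₁ (b ∷_) (shuffle (t ∷ τ) β)
  shuffle-take-β b+L≰t rewrite dec-false (b + length (b ∷ β) ≤? t) b+L≰t = refl

shuffle-τ-first : ∀ g j τ β → length β ≡ j → All (_≤ g) β →
  shuffle (g + j ∷ τ) β ≡ Prod.map (g ∷_) (j ∷_) (shuffle τ β)
shuffle-τ-first g j τ [] refl _ rewrite +-identityʳ g = refl
shuffle-τ-first g j τ (b ∷ β) refl (b≤g ∷ _)
  rewrite dec-true (b + j ≤? g + j) (+-monoˡ-≤ j b≤g) | m+n∸n≡m g j = refl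

shuffle-β-first : ∀ g τ β → All (_≤ g + length β) τ → shuffle τ (g ∷ β) ≡ Prod.map₁ (g ∷_) (shuffle τ β)
shuffle-β-first g [] β _ = refl
shuffle-β-first g (t ∷ τ) β (t≤ ∷ _)
  rewrite dec-false (g + length (g ∷ β) ≤? t) (<⇒≱ (≤-<-trans t≤ (+-monoʳ-< g (n<1+n (length β))))) = refl

step-down : ∀ {j y x} → Linked _≥_ (j ∷ y ∷ x) → y ≢ j → ∃ λ j′ → j ≡ suc j′ × Linked _≥_ (j′ ∷ y ∷ x)
step-down {zero} (y≤0 ∷ _) y≢0 = ⊥-elim (y≢0 (n≤0⇒n≡0 y≤0))
step-down {suc j′} (y≤j ∷ lk) y≢j = j′ , refl , (≤-pred (≤∧≢⇒< y≤j y≢j) ∷ lk)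

length-mismatch : ∀ j (x : List ℕ) → 0 ≢ j + suc (length x)
length-mismatch j x eq = 0≢1+n (trans eq (+-suc j (length x)))

unshuffle-length : ∀ j r x → Linked _≥_ (j ∷ x) → length r ≡ j + length x →
  length (proj₁ (unshuffle j r x)) ≡ length x × length (proj₂ (unshuffle j r x)) ≡ j
unshuffle-length j r [] _ eq = refl , trans eq (+-identityʳ j)
unshuffle-length j [] (y ∷ x) _ eq = ⊥-elim (length-mismatch j x eq)
unshuffle-length j (g ∷ r) (y ∷ x) jx eq with y ≟ j
... | yes refl rewrite unshuffle-hit j g r x =
  Prod.map₁ (cong suc) (unshuffle-length j r x (Linked.tail jx) (suc-injective (trans eq (+-suc j (length x)))))
... | no y≢j rewrite unshuffle-miss g r x y≢j with step-down jx y≢j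
...   | j′ , refl , jx′ = Prod.map₂ (cong suc) (unshuffle-length j′ r (y ∷ x) jx′ (suc-injective eq))

unshuffle-sum : ∀ j r x → Linked _≥_ (j ∷ x) → length r ≡ j + length x →
  sum (proj₁ (unshuffle j r x)) + sum (proj₂ (unshuffle j r x)) ≡ sum r + sum x
unshuffle-sum j r [] _ _ = sym (+-identityʳ (sum r))
unshuffle-sum j [] (y ∷ x) _ eq = ⊥-elim (length-mismatch j x eq)
unshuffle-sum j (g ∷ r) (y ∷ x) jx eq with y ≟ j
... | yes refl rewrite unshuffle-hit j g r x =
  let τ = proj₁ (unshuffle j r x); β = proj₂ (unshuffle j r x) in begin
  g + j + sum τ + sum β    ≡⟨ solve 4 (λ g j t b → g :+ j :+ t :+ b := g :+ j :+ (t :+ b)) refl g j (sum τ) (sum β) ⟩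
  g + j + (sum τ + sum β)  ≡⟨ cong (g + j +_) (unshuffle-sum j r x (Linked.tail jx) (suc-injective (trans eq (+-suc j (length x))))) ⟩
  g + j + (sum r + sum x)  ≡⟨ solve 4 (λ g j r x → g :+ j :+ (r :+ x) := g :+ r :+ (j :+ x)) refl g j (sum r) (sum x) ⟩
  g + sum r + (j + sum x)  ∎
... | no y≢j rewrite unshuffle-miss g r x y≢j with step-down jx y≢j
...   | j′ , refl , jx′ =
  let τ = proj₁ (unshuffle j′ r (y ∷ x)); β = proj₂ (unshuffle j′ r (y ∷ x)) in begin
  sum τ + (g + sum β)      ≡⟨ solve 3 (λ t g b → t :+ (g :+ b) := g :+ (t :+ b)) refl (sum τ) g (sum β) ⟩
  g + (sum τ + sum β)      ≡⟨ cong (g +_) (unshuffle-sum j′ r (y ∷ x) jx′ (suc-injective eq)) ⟩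
  g + (sum r + sum (y ∷ x)) ≡⟨ sym (+-assoc g (sum r) _) ⟩
  g + sum r + sum (y ∷ x)  ∎

unshuffle-bound : ∀ {c} j r x → All (_≤ c) r →
  All (_≤ c + j) (proj₁ (unshuffle j r x)) × All (_≤ c) (proj₂ (unshuffle j r x))
unshuffle-bound j r [] r≤c = [] , r≤c
unshuffle-bound j [] (y ∷ x) [] = [] , []
unshuffle-bound {c} j (g ∷ r) (y ∷ x) (g≤c ∷ r≤c) with y ≟ j
... | yes refl rewrite unshuffle-hit j g r x = Prod.map₁ (+-monoˡ-≤ j g≤c ∷_) (unshuffle-bound j r x r≤c)
... | no y≢j rewrite unshuffle-miss g r x y≢j =
  Prod.map (All.map (λ t≤ → ≤-trans t≤ (+-monoʳ-≤ c pred[n]≤n))) (g≤c ∷_) (unshuffle-bound (pred j) r (y ∷ x) r≤c)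

unshuffle-sorted : ∀ j r x → Linked _≥_ r →
  Linked _≥_ (proj₁ (unshuffle j r x)) × Linked _≥_ (proj₂ (unshuffle j r x))
unshuffle-sorted j r [] lr = [] , lr
unshuffle-sorted j [] (y ∷ x) _ = [] , []
unshuffle-sorted j (g ∷ r) (y ∷ x) lr with y ≟ j
... | yes refl rewrite unshuffle-hit j g r x =
  Prod.map₁ (≥-cons (proj₁ (unshuffle-bound j r x (≥-head lr)))) (unshuffle-sorted j r x (Linked.tail lr))
... | no y≢j rewrite unshuffle-miss g r x y≢j =
  Prod.map₂ (≥-cons (proj₂ (unshuffle-bound (pred j) r (y ∷ x) (≥-head lr)))) (unshuffle-sorted (pred j) r (y ∷ x) (Linked.tail lr))

shuffle∘unshuffle : ∀ j r x → Linked _≥_ r → Linked _≥_ (j ∷ x) → length r ≡ j + length x →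
  uncurry shuffle (unshuffle j r x) ≡ (r , x)
shuffle∘unshuffle j r [] _ _ _ = refl
shuffle∘unshuffle j [] (y ∷ x) _ _ eq = ⊥-elim (length-mismatch j x eq)
shuffle∘unshuffle j (g ∷ r) (y ∷ x) lr jx eq with y ≟ j
... | yes refl rewrite unshuffle-hit j g r x =
  let τ = proj₁ (unshuffle j r x); β = proj₂ (unshuffle j r x)
      eq′ = suc-injective (trans eq (+-suc j (length x))) in begin
  shuffle (g + j ∷ τ) β
    ≡⟨ shuffle-τ-first g j τ β (proj₂ (unshuffle-length j r x (Linked.tail jx) eq′)) (proj₂ (unshuffle-bound j r x (≥-head lr))) ⟩
  Prod.map (g ∷_) (j ∷_) (shuffle τ β)
    ≡⟨ cong (Prod.map (g ∷_) (j ∷_)) (shuffle∘unshuffle j r x (Linked.tail lr) (Linked.tail jx) eq′) ⟩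
  (g ∷ r , j ∷ x) ∎
... | no y≢j rewrite unshuffle-miss g r x y≢j with step-down jx y≢j
...   | j′ , refl , jx′ =
  let τ = proj₁ (unshuffle j′ r (y ∷ x)); β = proj₂ (unshuffle j′ r (y ∷ x))
      eq′ = suc-injective eq in begin
  shuffle τ (g ∷ β)
    ≡⟨ shuffle-β-first g τ β (subst (λ z → All (_≤ g + z) τ) (sym (proj₂ (unshuffle-length j′ r (y ∷ x) jx′ eq′)))
                                    (proj₁ (unshuffle-bound j′ r (y ∷ x) (≥-head lr)))) ⟩
  Prod.map₁ (g ∷_) (shuffle τ β)
    ≡⟨ cong (Prod.map₁ (g ∷_)) (shuffle∘unshuffle j′ r (y ∷ x) (Linked.tail lr) jx′ eq′) ⟩
  (g ∷ r , y ∷ x) ∎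

-- Here and below, both recursive calls are made before the comparison, which keeps the
-- lexicographic termination argument visible to Agda.
shuffle-length : ∀ τ β → length (proj₁ (shuffle τ β)) ≡ length τ + length β × length (proj₂ (shuffle τ β)) ≡ length τ
shuffle-length [] β = refl , refl
shuffle-length (t ∷ τ) [] = Prod.map (cong suc) (cong suc) (shuffle-length τ [])
shuffle-length (t ∷ τ) (b ∷ β) with shuffle-length τ (b ∷ β) | shuffle-length (t ∷ τ) β | b + length (b ∷ β) ≤? t
... | ih | _ | yes b+L≤t rewrite shuffle-take-τ {t} {b} {τ} {β} b+L≤t = Prod.map (cong suc) (cong suc) ih
... | _ | ih | no b+L≰t rewrite shuffle-take-β {t} {b} {τ} {β} b+L≰t =
  Prod.map₁ (λ eq → trans (cong suc eq) (sym (+-suc (length (t ∷ τ)) (length β)))) ih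

shuffle-bounded : ∀ τ β → Linked _≥_ (length β ∷ proj₂ (shuffle τ β))
shuffle-bounded [] β = [-]
shuffle-bounded (t ∷ τ) [] = z≤n ∷ shuffle-bounded τ []
shuffle-bounded (t ∷ τ) (b ∷ β) with shuffle-bounded τ (b ∷ β) | shuffle-bounded (t ∷ τ) β | b + length (b ∷ β) ≤? t
... | ih | _ | yes b+L≤t rewrite shuffle-take-τ {t} {b} {τ} {β} b+L≤t = ≤-refl ∷ ih
... | _ | ih | no b+L≰t rewrite shuffle-take-β {t} {b} {τ} {β} b+L≰t = ≥-raise (n≤1+n _) ih

shuffle-sorted′ : ∀ c τ β → Linked _≥_ (c + length β ∷ τ) → Linked _≥_ (c ∷ β) → Linked _≥_ (c ∷ proj₁ (shuffle τ β))
shuffle-sorted′ c [] β _ cβ = cβ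
shuffle-sorted′ c (t ∷ τ) [] (t≤c ∷ tτ) _ =
  subst (t ≤_) (+-identityʳ c) t≤c ∷ shuffle-sorted′ t τ [] (subst (λ z → Linked _≥_ (z ∷ τ)) (sym (+-identityʳ t)) tτ) [-]
shuffle-sorted′ c (t ∷ τ) (b ∷ β) (t≤c+L ∷ tτ) (b≤c ∷ bβ)
  with (λ c′ → shuffle-sorted′ c′ τ (b ∷ β)) | (λ c′ → shuffle-sorted′ c′ (t ∷ τ) β) | b + length (b ∷ β) ≤? t
... | ih | _ | yes b+L≤t rewrite shuffle-take-τ {t} {b} {τ} {β} b+L≤t =
  let L = length (b ∷ β); L≤t = ≤-trans (m≤n+m L b) b+L≤t in
  m≤n+o⇒m∸n≤o t L (subst (t ≤_) (+-comm c L) t≤c+L) ∷ ih (t ∸ L) (subst (λ z → Linked _≥_ (z ∷ τ)) (sym (m∸n+n≡m L≤t)) tτ) (m+n≤o⇒m≤o∸n b b+L≤t ∷ bβ)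
... | _ | ih | no b+L≰t rewrite shuffle-take-β {t} {b} {τ} {β} b+L≰t =
  b≤c ∷ ih b (≤-pred (subst (t <_) (+-suc b (length β)) (≰⇒> b+L≰t)) ∷ tτ) bβ

shuffle-sorted : ∀ τ β → Linked _≥_ τ → Linked _≥_ β → Linked _≥_ (proj₁ (shuffle τ β))
shuffle-sorted τ β lτ lβ with sorted-upper-bound lτ | sorted-upper-bound lβ
... | cτ , cτ∷τ | cβ , cβ∷β = Linked.tail (shuffle-sorted′ (cτ + cβ) τ β
  (≥-raise (≤-trans (m≤m+n cτ cβ) (m≤m+n _ (length β))) cτ∷τ) (≥-raise (m≤n+m cβ cτ) cβ∷β))

unshuffle-β-step : ∀ b j r x {τ β} → Linked _≥_ (j ∷ x) → unshuffle j r x ≡ (τ , β) → τ ≢ [] →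
  unshuffle (suc j) (b ∷ r) x ≡ (τ , b ∷ β)
unshuffle-β-step b j r [] _ eq τ≢[] = ⊥-elim (τ≢[] (sym (cong proj₁ eq)))
unshuffle-β-step b j r (y ∷ x) (y≤j ∷ _) eq _ = trans (unshuffle-miss b r x (<⇒≢ (s≤s y≤j))) (cong (Prod.map₂ (b ∷_)) eq)

unshuffle∘shuffle : ∀ τ β → unshuffle (length β) (proj₁ (shuffle τ β)) (proj₂ (shuffle τ β)) ≡ (τ , β)
unshuffle∘shuffle [] β = refl
unshuffle∘shuffle (t ∷ τ) [] rewrite unshuffle-hit 0 t (proj₁ (shuffle τ [])) (proj₂ (shuffle τ [])) | unshuffle∘shuffle τ [] | +-identityʳ t = refl
unshuffle∘shuffle (t ∷ τ) (b ∷ β) with unshuffle∘shuffle τ (b ∷ β) | unshuffle∘shuffle (t ∷ τ) β | b + length (b ∷ β) ≤? t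
... | ih | _ | yes b+L≤t rewrite shuffle-take-τ {t} {b} {τ} {β} b+L≤t =
  let L = length (b ∷ β); S = shuffle τ (b ∷ β) in begin
  unshuffle L (t ∸ L ∷ proj₁ S) (L ∷ proj₂ S)      ≡⟨ unshuffle-hit L (t ∸ L) (proj₁ S) (proj₂ S) ⟩
  Prod.map₁ (t ∸ L + L ∷_) (unshuffle L (proj₁ S) (proj₂ S)) ≡⟨ cong (Prod.map₁ (t ∸ L + L ∷_)) ih ⟩
  (t ∸ L + L ∷ τ , b ∷ β)                        ≡⟨ cong (λ z → (z ∷ τ , b ∷ β)) (m∸n+n≡m (≤-trans (m≤n+m L b) b+L≤t)) ⟩
  (t ∷ τ , b ∷ β) ∎
... | _ | ih | no b+L≰t rewrite shuffle-take-β {t} {b} {τ} {β} b+L≰t =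
  unshuffle-β-step b (length β) _ _ (shuffle-bounded (t ∷ τ) β) ih (λ ())

shuffle-sum : ∀ τ β → sum (proj₁ (shuffle τ β)) + sum (proj₂ (shuffle τ β)) ≡ sum τ + sum β
shuffle-sum τ β = begin
  sum r + sum x
    ≡⟨ sym (unshuffle-sum (length β) r x (shuffle-bounded τ β) r≡β+x) ⟩
  sum (proj₁ (unshuffle (length β) r x)) + sum (proj₂ (unshuffle (length β) r x))
    ≡⟨ cong (λ p → sum (proj₁ p) + sum (proj₂ p)) (unshuffle∘shuffle τ β) ⟩
  sum τ + sum β ∎
  where
  r = proj₁ (shuffle τ β)
  x = proj₂ (shuffle τ β)
  r≡β+x : length r ≡ length β + length x
  r≡β+x = let (r≡τ+β , x≡τ) = shuffle-length τ β in
    trans r≡τ+β (trans (+-comm (length τ) (length β)) (cong (length β +_) (sym x≡τ)))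

ShuffleInput : ℕ → ℕ → List ℕ × List ℕ → Set
ShuffleInput k m (r , x) = m ≤ k × Linked _≥_ r × length r ≡ k × Linked _≥_ (k ∸ m ∷ x) × length x ≡ m

ShuffleOutput : ℕ → ℕ → List ℕ × List ℕ → Set
ShuffleOutput k m (τ , β) = m ≤ k × Linked _≥_ τ × length τ ≡ m × Linked _≥_ β × length β ≡ k ∸ m

Weighted : (List ℕ × List ℕ → Set) → (List ℕ → Set) → (ℕ → List ℕ → ℕ) → ℕ → (List ℕ × List ℕ) × List ℕ → Set
Weighted P Q w n ((u , v) , Γ) = P (u , v) × Q Γ × w (sum u + sum v) Γ ≡ n

shuffleStage : ∀ {k m n} (Q : List ℕ → Set) (w : ℕ → List ℕ → ℕ) →
  SubsetInverse (Weighted (ShuffleInput k m) Q w n) (Weighted (ShuffleOutput k m) Q w n)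
shuffleStage {k} {m} Q w = record
  { to      = Prod.map₁ (uncurry (unshuffle (k ∸ m)))
  ; from    = Prod.map₁ (uncurry shuffle)
  ; to-∈    = λ { {(r , x) , Γ} ((m≤k , lr , r≡k , jx , x≡m) , qΓ , w≡n) →
                  let r≡j+x = split-length r x m≤k r≡k x≡m
                      (τ≡x , β≡j) = unshuffle-length (k ∸ m) r x jx r≡j+x
                      (lτ , lβ) = unshuffle-sorted (k ∸ m) r x lr in
                  (m≤k , lτ , trans τ≡x x≡m , lβ , β≡j) , qΓ ,
                  trans (cong (λ s → w s Γ) (unshuffle-sum (k ∸ m) r x jx r≡j+x)) w≡n }
  ; from-∈  = λ { {(τ , β) , Γ} ((m≤k , lτ , τ≡m , lβ , β≡j) , qΓ , w≡n) →
                  let (r≡τ+β , x≡τ) = shuffle-length τ β in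
                  (m≤k , shuffle-sorted τ β lτ lβ , trans r≡τ+β (trans (cong₂ _+_ τ≡m β≡j) (trans (+-comm m (k ∸ m)) (m∸n+n≡m m≤k))) ,
                   subst (λ j → Linked _≥_ (j ∷ proj₂ (shuffle τ β))) β≡j (shuffle-bounded τ β) , trans x≡τ τ≡m) , qΓ ,
                  trans (cong (λ s → w s Γ) (shuffle-sum τ β)) w≡n }
  ; from∘to = λ { {(r , x) , Γ} ((m≤k , lr , r≡k , jx , x≡m) , _) →
                  cong (_, Γ) (shuffle∘unshuffle (k ∸ m) r x lr jx (split-length r x m≤k r≡k x≡m)) }
  ; to∘from = λ { {(τ , β) , Γ} ((_ , _ , _ , _ , β≡j) , _) →
                  cong (_, Γ) (subst (λ j → unshuffle j (proj₁ (shuffle τ β)) (proj₂ (shuffle τ β)) ≡ (τ , β)) β≡j (unshuffle∘shuffle τ β)) }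
  }
  where
  split-length : ∀ (r x : List ℕ) → m ≤ k → length r ≡ k → length x ≡ m → length r ≡ k ∸ m + length x
  split-length _ _ m≤k r≡k x≡m = trans r≡k (trans (sym (m∸n+n≡m m≤k)) (cong (k ∸ m +_) (sym x≡m)))

-- Staircases, pairs of equal parts and sequences

triangle : ℕ → ℕ
triangle zero = 0
triangle (suc n) = n + triangle n

triangle-double : ∀ n → triangle (n + n) + n ≡ n * n + n * n
triangle-double zero = refl
triangle-double (suc n) = begin
  triangle (suc n + suc n) + suc n        ≡⟨ cong (λ t → triangle t + suc n) (cong suc (+-suc n n)) ⟩
  suc (n + n) + (n + n + triangle (n + n)) + suc n
    ≡⟨ solve 2 (λ n t → con 1 :+ (n :+ n) :+ (n :+ n :+ t) :+ (con 1 :+ n) := (t :+ n) :+ (con 2 :+ con 4 :* n)) refl n (triangle (n + n)) ⟩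
  (triangle (n + n) + n) + (2 + 4 * n)    ≡⟨ cong (_+ (2 + 4 * n)) (triangle-double n) ⟩
  n * n + n * n + (2 + 4 * n)             ≡⟨ solve 1 (λ n → n :* n :+ n :* n :+ (con 2 :+ con 4 :* n) := (con 1 :+ n) :* (con 1 :+ n) :+ (con 1 :+ n) :* (con 1 :+ n)) refl n ⟩
  suc n * suc n + suc n * suc n           ∎

-- Adding the staircase (ℓ − 1, …, 1, 0) turns blocks of equal parts into sequences of
-- consecutive parts.
addStaircase : List ℕ → List ℕ
addStaircase [] = []
addStaircase (x ∷ xs) = x + length xs ∷ addStaircase xs

removeStaircase : List ℕ → List ℕ
removeStaircase [] = []
removeStaircase (x ∷ xs) = x ∸ length xs ∷ removeStaircase xs

length-addStaircase : ∀ l → length (addStaircase l) ≡ length l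
length-addStaircase [] = refl
length-addStaircase (x ∷ l) = cong suc (length-addStaircase l)

length-removeStaircase : ∀ l → length (removeStaircase l) ≡ length l
length-removeStaircase [] = refl
length-removeStaircase (x ∷ l) = cong suc (length-removeStaircase l)

removeStaircase∘addStaircase : ∀ l → removeStaircase (addStaircase l) ≡ l
removeStaircase∘addStaircase [] = refl
removeStaircase∘addStaircase (x ∷ l)
  rewrite length-addStaircase l | m+n∸n≡m x (length l) = cong (x ∷_) (removeStaircase∘addStaircase l)

strict-length<head : ∀ {x xs} → Linked _>_ (x ∷ xs) → length xs ≤ x
strict-length<head {xs = []} _ = z≤n
strict-length<head {xs = y ∷ ys} (y<x ∷ lk) = ≤-trans (s≤s (strict-length<head lk)) y<x

addStaircase∘removeStaircase : ∀ l → Linked _>_ l → addStaircase (removeStaircase l) ≡ l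
addStaircase∘removeStaircase [] _ = refl
addStaircase∘removeStaircase (x ∷ l) lk
  rewrite length-removeStaircase l | m∸n+n≡m (strict-length<head lk) = cong (x ∷_) (addStaircase∘removeStaircase l (Linked.tail lk))

addStaircase-strict : ∀ {l} → Linked _≥_ l → Linked _>_ (addStaircase l)
addStaircase-strict [] = []
addStaircase-strict [-] = [-]
addStaircase-strict {x ∷ y ∷ l} (y≤x ∷ lk) = +-mono-≤-< y≤x ≤-refl ∷ addStaircase-strict lk

removeStaircase-sorted : ∀ {l} → Linked _>_ l → Linked _≥_ (removeStaircase l)
removeStaircase-sorted [] = []
removeStaircase-sorted [-] = [-]
removeStaircase-sorted {x ∷ y ∷ l} (y<x ∷ lk) = ∸-monoˡ-≤ (suc (length l)) y<x ∷ removeStaircase-sorted lk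

addStaircase-positive : ∀ {l} → All (1 ≤_) l → All (1 ≤_) (addStaircase l)
addStaircase-positive [] = []
addStaircase-positive {x ∷ l} (1≤x ∷ p) = ≤-trans 1≤x (m≤m+n x (length l)) ∷ addStaircase-positive p

removeStaircase-positive : ∀ {l} → Linked _>_ l → All (1 ≤_) l → All (1 ≤_) (removeStaircase l)
removeStaircase-positive [] [] = []
removeStaircase-positive {x ∷ l} lk (1≤x ∷ p) = m<n⇒0<n∸m (length<head lk 1≤x p) ∷ removeStaircase-positive (Linked.tail lk) p
  where
  length<head : ∀ {x l} → Linked _>_ (x ∷ l) → 1 ≤ x → All (1 ≤_) l → length l < x
  length<head [-] 1≤x [] = 1≤x
  length<head (y<x ∷ lk) _ (1≤y ∷ p) = ≤-<-trans (length<head lk 1≤y p) y<x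

sum-addStaircase : ∀ l → sum (addStaircase l) ≡ sum l + triangle (length l)
sum-addStaircase [] = refl
sum-addStaircase (x ∷ l) rewrite sum-addStaircase l =
  solve 4 (λ x n s t → x :+ n :+ (s :+ t) := x :+ s :+ (n :+ t)) refl x (length l) (sum l) (triangle (length l))

-- pairUp ν = (ρ , S): one copy of each pair of equal parts, and the unpaired parts, one per
-- block of odd multiplicity.
pairUp : List ℕ → List ℕ × List ℕ
pairUp [] = [] , []
pairUp (x ∷ []) = [] , x ∷ []
pairUp (x ∷ y ∷ l) = if does (x ≟ y) then Prod.map₁ (x ∷_) (pairUp l) else Prod.map₂ (x ∷_) (pairUp (y ∷ l))

pairUp-pair : ∀ x l → pairUp (x ∷ x ∷ l) ≡ Prod.map₁ (x ∷_) (pairUp l)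
pairUp-pair x l rewrite dec-true (x ≟ x) refl = refl

pairUp-single : ∀ {x y} l → x ≢ y → pairUp (x ∷ y ∷ l) ≡ Prod.map₂ (x ∷_) (pairUp (y ∷ l))
pairUp-single {x} {y} l x≢y rewrite dec-false (x ≟ y) x≢y = refl

twice : List ℕ → List ℕ
twice [] = []
twice (r ∷ ρ) = r ∷ r ∷ twice ρ

unpair : List ℕ → List ℕ → List ℕ
unpair ρ S = merge _≥?_ (twice ρ) S

twice-All : ∀ {P : ℕ → Set} {ρ} → All P ρ → All P (twice ρ)
twice-All [] = []
twice-All (p ∷ ps) = p ∷ p ∷ twice-All ps

twice-sorted : ∀ {ρ} → Linked _≥_ ρ → Linked _≥_ (twice ρ)
twice-sorted [] = []
twice-sorted [-] = ≤-refl ∷ [-]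
twice-sorted (r≥r′ ∷ lk) = ≤-refl ∷ r≥r′ ∷ twice-sorted lk

length-twice : ∀ ρ → length (twice ρ) ≡ length ρ + length ρ
length-twice [] = refl
length-twice (r ∷ ρ) = cong suc (trans (cong suc (length-twice ρ)) (sym (+-suc (length ρ) (length ρ))))

sum-twice : ∀ ρ → sum (twice ρ) ≡ sum ρ + sum ρ
sum-twice [] = refl
sum-twice (r ∷ ρ) rewrite sum-twice ρ = solve 2 (λ r s → r :+ (r :+ (s :+ s)) := r :+ s :+ (r :+ s)) refl r (sum ρ)

unpair-sorted : ∀ {ρ S} → Linked _≥_ ρ → Linked _≥_ S → Linked _≥_ (unpair ρ S)
unpair-sorted lρ lS = merge⁺ (Flip.decTotalOrder ≤-decTotalOrder) (twice-sorted lρ) lS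

unpair-All : ∀ {P : ℕ → Set} {ρ S} → All P ρ → All P S → All P (unpair ρ S)
unpair-All {ρ = ρ} {S} pρ pS = All-resp-↭ (↭-sym (merge-↭ _≥?_ (twice ρ) S)) (All.++⁺ (twice-All pρ) pS)

unpair-length : ∀ ρ S → length (unpair ρ S) ≡ length ρ + length ρ + length S
unpair-length ρ S = begin
  length (unpair ρ S)          ≡⟨ ↭-length (merge-↭ _≥?_ (twice ρ) S) ⟩
  length (twice ρ ++ S)        ≡⟨ length-++ (twice ρ) ⟩
  length (twice ρ) + length S  ≡⟨ cong (_+ length S) (length-twice ρ) ⟩
  length ρ + length ρ + length S ∎

unpair-sum : ∀ ρ S → sum (unpair ρ S) ≡ sum ρ + sum ρ + sum S
unpair-sum ρ S = begin
  sum (unpair ρ S)          ≡⟨ sum-↭ (merge-↭ _≥?_ (twice ρ) S) ⟩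
  sum (twice ρ ++ S)        ≡⟨ sum-++ (twice ρ) S ⟩
  sum (twice ρ) + sum S     ≡⟨ cong (_+ sum S) (sum-twice ρ) ⟩
  sum ρ + sum ρ + sum S     ∎

merge-[]ʳ : ∀ xs → merge _≥?_ xs [] ≡ xs
merge-[]ʳ [] = refl
merge-[]ʳ (_ ∷ _) = refl

merge-head-left : ∀ {x} xs S → All (_≤ x) S → merge _≥?_ (x ∷ xs) S ≡ x ∷ merge _≥?_ xs S
merge-head-left xs [] [] = cong (_ ∷_) (sym (merge-[]ʳ xs))
merge-head-left {x} xs (s ∷ S) (s≤x ∷ _) rewrite dec-true (s ≤? x) s≤x = refl

merge-head-right : ∀ {y} xs S → All (_< y) xs → merge _≥?_ xs (y ∷ S) ≡ y ∷ merge _≥?_ xs S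
merge-head-right [] S _ = refl
merge-head-right {y} (x ∷ xs) S (x<y ∷ _) rewrite dec-false (y ≤? x) (<⇒≱ x<y) = refl

pairUp-All : ∀ {P : ℕ → Set} {l} → All P l → All P (proj₁ (pairUp l)) × All P (proj₂ (pairUp l))
pairUp-All [] = [] , []
pairUp-All (p ∷ []) = [] , p ∷ []
pairUp-All {l = x ∷ y ∷ l} (p ∷ q ∷ ps) with pairUp-All ps | pairUp-All (q ∷ ps) | x ≟ y
... | ih | _ | yes refl rewrite pairUp-pair x l = Prod.map₁ (p ∷_) ih
... | _ | ih | no x≢y rewrite pairUp-single l x≢y = Prod.map₂ (p ∷_) ih

pairUp-cons-single : ∀ x l → All (_< x) l → pairUp (x ∷ l) ≡ Prod.map₂ (x ∷_) (pairUp l)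
pairUp-cons-single x [] _ = refl
pairUp-cons-single x (y ∷ l) (y<x ∷ _) = pairUp-single l (>⇒≢ y<x)

pairUp-strict : ∀ {S} → Linked _>_ S → pairUp S ≡ ([] , S)
pairUp-strict {[]} _ = refl
pairUp-strict {x ∷ S} lk rewrite pairUp-cons-single x S (>-head lk) | pairUp-strict (Linked.tail lk) = refl

pairUp-sorted : ∀ {ν} → Linked _≥_ ν → Linked _≥_ (proj₁ (pairUp ν)) × Linked _>_ (proj₂ (pairUp ν))
pairUp-sorted [] = [] , []
pairUp-sorted [-] = [] , [-]
pairUp-sorted {x ∷ y ∷ l} (y≤x ∷ lk) with pairUp-sorted (Linked.tail lk) | pairUp-sorted lk | x ≟ y
... | ρ , S | _ | yes refl rewrite pairUp-pair x l = ≥-cons (proj₁ (pairUp-All (≥-head lk))) ρ , S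
... | _ | ρ , S | no x≢y rewrite pairUp-single l x≢y =
  ρ , >-cons (proj₂ (pairUp-All {l = y ∷ l} (All.map (λ z≤y → ≤-<-trans z≤y y<x) (≤-refl ∷ ≥-head lk)))) S
  where y<x = ≤∧≢⇒< y≤x (≢-sym x≢y)

unpair∘pairUp : ∀ {ν} → Linked _≥_ ν → uncurry unpair (pairUp ν) ≡ ν
unpair∘pairUp [] = refl
unpair∘pairUp [-] = refl
unpair∘pairUp {x ∷ y ∷ l} (y≤x ∷ lk) with unpair∘pairUp (Linked.tail lk) | unpair∘pairUp lk | x ≟ y
... | ih | _ | yes refl rewrite pairUp-pair x l =
  let ρ = proj₁ (pairUp l); S = proj₂ (pairUp l); S≤x = proj₂ (pairUp-All (≥-head lk)) in begin
  merge _≥?_ (x ∷ x ∷ twice ρ) S  ≡⟨ merge-head-left (x ∷ twice ρ) S S≤x ⟩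
  x ∷ merge _≥?_ (x ∷ twice ρ) S  ≡⟨ cong (x ∷_) (merge-head-left (twice ρ) S S≤x) ⟩
  x ∷ x ∷ unpair ρ S              ≡⟨ cong (λ l → x ∷ x ∷ l) ih ⟩
  x ∷ x ∷ l                       ∎
... | _ | ih | no x≢y rewrite pairUp-single l x≢y =
  let ρ = proj₁ (pairUp (y ∷ l)); S = proj₂ (pairUp (y ∷ l))
      y∷l<x = All.map (λ z≤y → ≤-<-trans z≤y (≤∧≢⇒< y≤x (≢-sym x≢y))) (≤-refl ∷ ≥-head lk) in begin
  merge _≥?_ (twice ρ) (x ∷ S)  ≡⟨ merge-head-right (twice ρ) S (twice-All (proj₁ (pairUp-All y∷l<x))) ⟩
  x ∷ unpair ρ S                ≡⟨ cong (x ∷_) ih ⟩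
  x ∷ y ∷ l                     ∎

pairUp∘unpair : ∀ {ρ S} → Linked _≥_ ρ → Linked _>_ S → pairUp (unpair ρ S) ≡ (ρ , S)
pairUp∘unpair {[]} _ lS = pairUp-strict lS
pairUp∘unpair {r ∷ ρ} {[]} lρ _ = begin
  pairUp (r ∷ r ∷ twice ρ)                 ≡⟨ pairUp-pair r (twice ρ) ⟩
  Prod.map₁ (r ∷_) (pairUp (twice ρ))      ≡⟨ cong (λ l → Prod.map₁ (r ∷_) (pairUp l)) (sym (merge-[]ʳ (twice ρ))) ⟩
  Prod.map₁ (r ∷_) (pairUp (unpair ρ []))  ≡⟨ cong (Prod.map₁ (r ∷_)) (pairUp∘unpair (Linked.tail lρ) []) ⟩
  (r ∷ ρ , [])                             ∎
pairUp∘unpair {r ∷ ρ} {s ∷ S} lρ lS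
  with pairUp∘unpair {ρ} {s ∷ S} (Linked.tail lρ) lS | pairUp∘unpair {r ∷ ρ} {S} lρ (Linked.tail lS) | s ≤? r
... | ih | _ | yes s≤r =
  let s∷S≤r = s≤r ∷ All.map (λ z<s → <⇒≤ (<-≤-trans z<s s≤r)) (>-head lS) in begin
  pairUp (merge _≥?_ (r ∷ r ∷ twice ρ) (s ∷ S))  ≡⟨ cong pairUp (merge-head-left (r ∷ twice ρ) (s ∷ S) s∷S≤r) ⟩
  pairUp (r ∷ merge _≥?_ (r ∷ twice ρ) (s ∷ S))  ≡⟨ cong (λ l → pairUp (r ∷ l)) (merge-head-left (twice ρ) (s ∷ S) s∷S≤r) ⟩
  pairUp (r ∷ r ∷ unpair ρ (s ∷ S))              ≡⟨ pairUp-pair r (unpair ρ (s ∷ S)) ⟩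
  Prod.map₁ (r ∷_) (pairUp (unpair ρ (s ∷ S)))   ≡⟨ cong (Prod.map₁ (r ∷_)) ih ⟩
  (r ∷ ρ , s ∷ S)                                ∎
... | _ | ih | no s≰r =
  let r<s = ≰⇒> s≰r
      r∷ρ<s = All.map (λ z≤r → ≤-<-trans z≤r r<s) (≤-refl ∷ ≥-head lρ) in begin
  pairUp (merge _≥?_ (twice (r ∷ ρ)) (s ∷ S))  ≡⟨ cong pairUp (merge-head-right (twice (r ∷ ρ)) S (twice-All r∷ρ<s)) ⟩
  pairUp (s ∷ unpair (r ∷ ρ) S)                ≡⟨ pairUp-cons-single s (unpair (r ∷ ρ) S) (unpair-All r∷ρ<s (>-head lS)) ⟩
  Prod.map₂ (s ∷_) (pairUp (unpair (r ∷ ρ) S)) ≡⟨ cong (Prod.map₂ (s ∷_)) ih ⟩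
  (r ∷ ρ , s ∷ S)                              ∎

oddCount : List ℕ → ℕ
oddCount cs = length (filter (λ c → c % 2 ≟ 1) cs)

oddCount-cong : ∀ c d l → c % 2 ≡ d % 2 → oddCount (c ∷ l) ≡ oddCount (d ∷ l)
oddCount-cong c d l eq with c % 2 ≟ 1
... | yes odd = trans (cong length (filter-accept odd? {c} {l} odd)) (sym (cong length (filter-accept odd? {d} {l} (trans (sym eq) odd))))
  where odd? = λ c → c % 2 ≟ 1
... | no even = trans (cong length (filter-reject odd? {c} {l} even)) (sym (cong length (filter-reject odd? {d} {l} (λ odd → even (trans eq odd)))))
  where odd? = λ c → c % 2 ≟ 1

runsGo-parity : ∀ p c l → oddCount (runsGo p (2 + c) l) ≡ oddCount (runsGo p c l)
runsGo-parity p c [] = oddCount-cong (2 + c) c [] (trans (cong (_% 2) (+-comm 2 c)) ([m+n]%n≡m%n c 2))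
runsGo-parity p c (x ∷ xs) with suc x ≡ᵇ p
... | true = runsGo-parity x (suc c) xs
... | false = oddCount-cong (2 + c) c (runsGo x 1 xs) (trans (cong (_% 2) (+-comm 2 c)) ([m+n]%n≡m%n c 2))

staircase-consecutive : ∀ x n → (suc (x + n) ≡ᵇ x + suc n) ≡ true
staircase-consecutive x n = dec-true (suc (x + n) ≟ x + suc n) (sym (+-suc x n))

staircase-gap : ∀ {x y} n → x ≢ y → (suc (y + n) ≡ᵇ x + suc n) ≡ false
staircase-gap {x} {y} n x≢y = dec-false (suc (y + n) ≟ x + suc n) (λ eq → x≢y (sym (+-cancelʳ-≡ n y x (suc-injective (trans eq (+-suc x n))))))

mutual
  oddRuns-addStaircase : ∀ x ys → oddCount (runsGo (x + length ys) 1 (addStaircase ys)) ≡ length (proj₂ (pairUp (x ∷ ys)))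
  oddRuns-addStaircase x [] = refl
  oddRuns-addStaircase x (y ∷ zs) with x ≟ y
  ... | no x≢y rewrite staircase-gap (length zs) x≢y | pairUp-single zs x≢y = cong suc (oddRuns-addStaircase y zs)
  ... | yes refl rewrite staircase-consecutive x (length zs) | pairUp-pair x zs =
    trans (runsGo-parity (x + length zs) 0 (addStaircase zs)) (oddRuns-afterPair x zs)

  oddRuns-afterPair : ∀ x zs → oddCount (runsGo (x + length zs) 0 (addStaircase zs)) ≡ length (proj₂ (pairUp zs))
  oddRuns-afterPair x [] = refl
  oddRuns-afterPair x (w ∷ ws) with x ≟ w
  ... | yes refl rewrite staircase-consecutive x (length ws) = oddRuns-addStaircase x ws
  ... | no x≢w rewrite staircase-gap (length ws) x≢w = oddRuns-addStaircase w ws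

oddSeqCount-addStaircase : ∀ ν → oddSeqCount (addStaircase ν) ≡ length (proj₂ (pairUp ν))
oddSeqCount-addStaircase [] = refl
oddSeqCount-addStaircase (x ∷ ys) = oddRuns-addStaircase x ys

-- Gaps, interleavings and multiplicities

suffixSums : List ℕ → List ℕ
suffixSums [] = []
suffixSums (g ∷ gs) = g + sum gs ∷ suffixSums gs

differences : List ℕ → List ℕ
differences [] = []
differences (x ∷ []) = x ∷ []
differences (x ∷ y ∷ l) = x ∸ y ∷ differences (y ∷ l)

length-suffixSums : ∀ gs → length (suffixSums gs) ≡ length gs
length-suffixSums [] = refl
length-suffixSums (g ∷ gs) = cong suc (length-suffixSums gs)

length-differences : ∀ l → length (differences l) ≡ length l
length-differences [] = refl
length-differences (x ∷ []) = refl
length-differences (x ∷ y ∷ l) = cong suc (length-differences (y ∷ l))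

suffixSums-sorted : ∀ gs → Linked _≥_ (suffixSums gs)
suffixSums-sorted [] = []
suffixSums-sorted (g ∷ []) = [-]
suffixSums-sorted (g ∷ h ∷ gs) = m≤n+m (h + sum gs) g ∷ suffixSums-sorted (h ∷ gs)

differences∘suffixSums : ∀ gs → differences (suffixSums gs) ≡ gs
differences∘suffixSums [] = refl
differences∘suffixSums (g ∷ []) = cong (_∷ []) (+-identityʳ g)
differences∘suffixSums (g ∷ h ∷ gs) = cong₂ _∷_ (m+n∸n≡m g (h + sum gs)) (differences∘suffixSums (h ∷ gs))

sum-differences : ∀ {x l} → Linked _≥_ (x ∷ l) → sum (differences (x ∷ l)) ≡ x
sum-differences {x} [-] = +-identityʳ x
sum-differences {x} {y ∷ l} (y≤x ∷ lk) = trans (cong (x ∸ y +_) (sum-differences lk)) (m∸n+n≡m y≤x)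

suffixSums∘differences : ∀ {l} → Linked _≥_ l → suffixSums (differences l) ≡ l
suffixSums∘differences [] = refl
suffixSums∘differences {x ∷ []} [-] = cong (_∷ []) (+-identityʳ x)
suffixSums∘differences {x ∷ y ∷ l} (y≤x ∷ lk) =
  cong₂ _∷_ (trans (cong (x ∸ y +_) (sum-differences lk)) (m∸n+n≡m y≤x)) (suffixSums∘differences lk)

interleave : List ℕ → List ℕ → List ℕ
interleave [] v = []
interleave (x ∷ u) v = x ∷ interleave v u

deinterleave : List ℕ → List ℕ × List ℕ
deinterleave [] = [] , []
deinterleave (x ∷ l) = Prod.map₁ (x ∷_) (Prod.swap (deinterleave l))

Balanced : List ℕ → List ℕ → Set
Balanced u v = length v ≤ length u × length u ≤ suc (length v)

balanced-swap : ∀ x u v → Balanced (x ∷ u) v → Balanced v u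
balanced-swap _ _ _ (v≤x∷u , s≤s u≤v) = u≤v , v≤x∷u

interleave∘deinterleave : ∀ l → uncurry interleave (deinterleave l) ≡ l
interleave∘deinterleave [] = refl
interleave∘deinterleave (x ∷ l) = cong (x ∷_) (interleave∘deinterleave l)

deinterleave∘interleave : ∀ u v → Balanced u v → deinterleave (interleave u v) ≡ (u , v)
deinterleave∘interleave [] [] _ = refl
deinterleave∘interleave (x ∷ u) v bal rewrite deinterleave∘interleave v u (balanced-swap x u v bal) = refl

length-interleave : ∀ u v → Balanced u v → length (interleave u v) ≡ length u + length v
length-interleave [] [] _ = refl
length-interleave (x ∷ u) v bal rewrite length-interleave v u (balanced-swap x u v bal) = cong suc (+-comm (length v) (length u))

length-deinterleave : ∀ M m l → m ≤ M → M ≤ suc m → length l ≡ M + m →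
  length (proj₁ (deinterleave l)) ≡ M × length (proj₂ (deinterleave l)) ≡ m
length-deinterleave zero zero [] _ _ _ = refl , refl
length-deinterleave (suc M) m (x ∷ l) m≤1+M (s≤s M≤m) eq
  with length-deinterleave m M l M≤m m≤1+M (trans (suc-injective eq) (+-comm M m))
... | u≡m , v≡M = cong suc v≡M , u≡m

sum-interleave : ∀ u v → Balanced u v → sum (interleave u v) ≡ sum u + sum v
sum-interleave [] [] _ = refl
sum-interleave (x ∷ u) v bal rewrite sum-interleave v u (balanced-swap x u v bal) =
  trans (cong (x +_) (+-comm (sum v) (sum u))) (sym (+-assoc x (sum u) (sum v)))

sum-suffixSums-interleave : ∀ u v → Balanced u v →
  sum (suffixSums (interleave u v)) + sum u ≡ (sum (suffixSums u) + sum (suffixSums u)) + (sum (suffixSums v) + sum (suffixSums v))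
sum-suffixSums-interleave [] [] _ = refl
sum-suffixSums-interleave (x ∷ u) v bal =
  let I = interleave v u; bal′ = balanced-swap x u v bal in begin
  x + sum I + sum (suffixSums I) + (x + sum u)
    ≡⟨ cong (λ s → x + s + sum (suffixSums I) + (x + sum u)) (sum-interleave v u bal′) ⟩
  x + (sum v + sum u) + sum (suffixSums I) + (x + sum u)
    ≡⟨ solve 4 (λ x v u I → x :+ (v :+ u) :+ I :+ (x :+ u) := (I :+ v) :+ (x :+ u :+ (x :+ u))) refl x (sum v) (sum u) (sum (suffixSums I)) ⟩
  (sum (suffixSums I) + sum v) + (x + sum u + (x + sum u))
    ≡⟨ cong (_+ (x + sum u + (x + sum u))) (sum-suffixSums-interleave v u bal′) ⟩
  (sum (suffixSums v) + sum (suffixSums v) + (sum (suffixSums u) + sum (suffixSums u))) + (x + sum u + (x + sum u))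
    ≡⟨ solve 3 (λ a c d → a :+ a :+ (c :+ c) :+ (d :+ d) := (d :+ c) :+ (d :+ c) :+ (a :+ a)) refl (sum (suffixSums v)) (sum (suffixSums u)) (x + sum u) ⟩
  (x + sum u + sum (suffixSums u)) + (x + sum u + sum (suffixSums u)) + (sum (suffixSums v) + sum (suffixSums v)) ∎

-- cs is a vector of multiplicities: expand cs has cs₀ parts 0, cs₁ parts 1, and so on.
expand : List ℕ → List ℕ
expand [] = []
expand (c ∷ cs) = map suc (expand cs) ++ replicate c 0

-- The positive parts, each lowered by one, and the number of zero parts; the second clause
-- presumes Γ weakly decreasing, so that only zeros follow a zero.
peel : List ℕ → List ℕ × ℕ
peel [] = [] , 0
peel (zero ∷ Γ) = [] , suc (length Γ)
peel (suc x ∷ Γ) = Prod.map₁ (x ∷_) (peel Γ)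

compress : ℕ → List ℕ → List ℕ
compress zero Γ = []
compress (suc M) Γ = proj₂ (peel Γ) ∷ compress M (proj₁ (peel Γ))

length-compress : ∀ M Γ → length (compress M Γ) ≡ M
length-compress zero Γ = refl
length-compress (suc M) Γ = cong suc (length-compress M (proj₁ (peel Γ)))

length-expand : ∀ cs → length (expand cs) ≡ sum cs
length-expand [] = refl
length-expand (c ∷ cs) = begin
  length (map suc (expand cs) ++ replicate c 0)           ≡⟨ length-++ (map suc (expand cs)) ⟩
  length (map suc (expand cs)) + length (replicate c 0)   ≡⟨ cong₂ _+_ (trans (length-map suc (expand cs)) (length-expand cs)) (length-replicate c) ⟩
  sum cs + c                                              ≡⟨ +-comm (sum cs) c ⟩
  c + sum cs ∎

sum-expand : ∀ cs → sum (expand cs) + sum cs ≡ sum (suffixSums cs)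
sum-expand [] = refl
sum-expand (c ∷ cs) = let E = expand cs in begin
  sum (map suc E ++ replicate c 0) + (c + sum cs)
    ≡⟨ cong (_+ (c + sum cs)) (trans (sum-++ (map suc E) (replicate c 0)) (cong₂ _+_ (sum-map-suc E) (sum-replicate-zero c))) ⟩
  sum E + length E + 0 + (c + sum cs)
    ≡⟨ cong (λ n → sum E + n + 0 + (c + sum cs)) (length-expand cs) ⟩
  sum E + sum cs + 0 + (c + sum cs)
    ≡⟨ solve 3 (λ e s c → e :+ s :+ con 0 :+ (c :+ s) := c :+ s :+ (e :+ s)) refl (sum E) (sum cs) c ⟩
  c + sum cs + (sum E + sum cs)
    ≡⟨ cong (c + sum cs +_) (sum-expand cs) ⟩
  c + sum cs + sum (suffixSums cs) ∎
  where
  sum-replicate-zero : ∀ c → sum (replicate c 0) ≡ 0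
  sum-replicate-zero zero = refl
  sum-replicate-zero (suc c) = sum-replicate-zero c

expand-sorted : ∀ cs → Linked _≥_ (expand cs)
expand-sorted [] = []
expand-sorted (c ∷ cs) = sorted-++ (map suc (expand cs)) (replicate c 0) (Linked.map⁺ (Linked.map s≤s (expand-sorted cs)))
  (replicate-sorted c 0) (All.universal (λ _ → z≤n) _) (All.replicate⁺ c z≤n)

expand-bounded : ∀ cs → All (_< length cs) (expand cs)
expand-bounded [] = []
expand-bounded (c ∷ cs) = All.++⁺ (All.map⁺ (All.map s≤s (expand-bounded cs))) (All.replicate⁺ c (s≤s z≤n))

peel-expand : ∀ E c → peel (map suc E ++ replicate c 0) ≡ (E , c)
peel-expand [] zero = refl
peel-expand [] (suc c) = cong (λ n → [] , suc n) (length-replicate c)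
peel-expand (e ∷ E) c = cong (Prod.map₁ (e ∷_)) (peel-expand E c)

compress∘expand : ∀ cs → compress (length cs) (expand cs) ≡ cs
compress∘expand [] = refl
compress∘expand (c ∷ cs) rewrite peel-expand (expand cs) c = cong (c ∷_) (compress∘expand cs)

peel-spec : ∀ {Γ} → Linked _≥_ Γ → map suc (proj₁ (peel Γ)) ++ replicate (proj₂ (peel Γ)) 0 ≡ Γ
peel-spec {[]} _ = refl
peel-spec {zero ∷ Γ} lk = cong (0 ∷_) (zeros (≥-head lk))
  where
  zeros : ∀ {l} → All (_≤ 0) l → replicate (length l) 0 ≡ l
  zeros [] = refl
  zeros (z≤n ∷ p) = cong (0 ∷_) (zeros p)
peel-spec {suc x ∷ Γ} lk = cong (suc x ∷_) (peel-spec (Linked.tail lk))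

peel-sorted : ∀ {Γ} → Linked _≥_ Γ → Linked _≥_ (proj₁ (peel Γ))
peel-sorted {[]} _ = []
peel-sorted {zero ∷ Γ} _ = []
peel-sorted {suc x ∷ []} _ = [-]
peel-sorted {suc x ∷ zero ∷ Γ} _ = [-]
peel-sorted {suc x ∷ suc y ∷ Γ} (s≤s y≤x ∷ lk) = y≤x ∷ peel-sorted lk

peel-bounded : ∀ {M Γ} → All (_< suc M) Γ → All (_< M) (proj₁ (peel Γ))
peel-bounded {Γ = []} _ = []
peel-bounded {Γ = zero ∷ Γ} _ = []
peel-bounded {Γ = suc x ∷ Γ} (s≤s x<M ∷ p) = x<M ∷ peel-bounded p

expand∘compress : ∀ M {Γ} → Linked _≥_ Γ → All (_< M) Γ → expand (compress M Γ) ≡ Γ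
expand∘compress zero {[]} _ _ = refl
expand∘compress zero {_ ∷ _} _ (() ∷ _)
expand∘compress (suc M) {Γ} lk bound = begin
  map suc (expand (compress M (proj₁ (peel Γ)))) ++ replicate (proj₂ (peel Γ)) 0
    ≡⟨ cong (λ P → map suc P ++ replicate (proj₂ (peel Γ)) 0) (expand∘compress M (peel-sorted lk) (peel-bounded bound)) ⟩
  map suc (proj₁ (peel Γ)) ++ replicate (proj₂ (peel Γ)) 0
    ≡⟨ peel-spec lk ⟩
  Γ ∎

-- Partitions into distinct parts

strictOfGaps : List ℕ → List ℕ
strictOfGaps g = addStaircase (map suc (suffixSums g))

gapsOfStrict : List ℕ → List ℕ
gapsOfStrict S = differences (map pred (removeStaircase S))

strictOfGaps-strict : ∀ g → Linked _>_ (strictOfGaps g)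
strictOfGaps-strict g = addStaircase-strict (Linked.map⁺ (Linked.map s≤s (suffixSums-sorted g)))

strictOfGaps-positive : ∀ g → All (1 ≤_) (strictOfGaps g)
strictOfGaps-positive g = addStaircase-positive (All.map⁺ (All.universal (λ _ → s≤s z≤n) (suffixSums g)))

length-strictOfGaps : ∀ g → length (strictOfGaps g) ≡ length g
length-strictOfGaps g = trans (length-addStaircase (map suc (suffixSums g))) (trans (length-map suc (suffixSums g)) (length-suffixSums g))

length-gapsOfStrict : ∀ S → length (gapsOfStrict S) ≡ length S
length-gapsOfStrict S = trans (length-differences (map pred (removeStaircase S))) (trans (length-map pred (removeStaircase S)) (length-removeStaircase S))

sum-strictOfGaps : ∀ g → sum (strictOfGaps g) ≡ sum (suffixSums g) + length g + triangle (length g)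
sum-strictOfGaps g = begin
  sum (addStaircase (map suc (suffixSums g)))
    ≡⟨ sum-addStaircase (map suc (suffixSums g)) ⟩
  sum (map suc (suffixSums g)) + triangle (length (map suc (suffixSums g)))
    ≡⟨ cong₂ _+_ (sum-map-suc (suffixSums g)) (cong triangle (trans (length-map suc (suffixSums g)) (length-suffixSums g))) ⟩
  sum (suffixSums g) + length (suffixSums g) + triangle (length g)
    ≡⟨ cong (λ n → sum (suffixSums g) + n + triangle (length g)) (length-suffixSums g) ⟩
  sum (suffixSums g) + length g + triangle (length g) ∎

gapsOfStrict∘strictOfGaps : ∀ g → gapsOfStrict (strictOfGaps g) ≡ g
gapsOfStrict∘strictOfGaps g = begin
  differences (map pred (removeStaircase (addStaircase (map suc (suffixSums g)))))
    ≡⟨ cong (λ l → differences (map pred l)) (removeStaircase∘addStaircase (map suc (suffixSums g))) ⟩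
  differences (map pred (map suc (suffixSums g)))
    ≡⟨ cong differences (map-pred∘map-suc (suffixSums g)) ⟩
  differences (suffixSums g)
    ≡⟨ differences∘suffixSums g ⟩
  g ∎

strictOfGaps∘gapsOfStrict : ∀ {S} → Linked _>_ S → All (1 ≤_) S → strictOfGaps (gapsOfStrict S) ≡ S
strictOfGaps∘gapsOfStrict {S} lS pS = begin
  addStaircase (map suc (suffixSums (differences (map pred (removeStaircase S)))))
    ≡⟨ cong (λ l → addStaircase (map suc l)) (suffixSums∘differences (Linked.map⁺ (Linked.map pred-mono-≤ (removeStaircase-sorted lS)))) ⟩
  addStaircase (map suc (map pred (removeStaircase S)))
    ≡⟨ cong addStaircase (map-suc∘map-pred (removeStaircase-positive lS pS)) ⟩
  addStaircase (removeStaircase S)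
    ≡⟨ addStaircase∘removeStaircase S lS ⟩
  S ∎

splitSingletons : List ℕ → List ℕ × List ℕ
splitSingletons S = suffixSums (proj₂ g) , expand (proj₁ g)
  where g = deinterleave (gapsOfStrict S)

-- The i-th gap of S counts i times in its size: the multiplicity of the part v of Γ sits at
-- position 2v + 1, and the gaps of τ at even positions.
joinSingletons : ℕ → List ℕ → List ℕ → List ℕ
joinSingletons M τ Γ = strictOfGaps (interleave (compress M Γ) (differences τ))

PartsBelow : ℕ → List ℕ → Set
PartsBelow M Γ = Linked _≥_ Γ × All (_< M) Γ

splitDistinct : List ℕ → List ℕ × List ℕ
splitDistinct μ = Prod.map₁ (map pred) (pairUp (removeStaircase μ))

joinDistinct : List ℕ → List ℕ → List ℕ
joinDistinct β S = addStaircase (unpair (map suc β) S)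

joinDistinct-valid : ∀ β S → Linked _≥_ β → Linked _>_ S → All (1 ≤_) S →
  Linked _>_ (joinDistinct β S) × All (1 ≤_) (joinDistinct β S)
  × length (joinDistinct β S) ≡ length β + length β + length S × oddSeqCount (joinDistinct β S) ≡ length S
joinDistinct-valid β S lβ lS pS =
  addStaircase-strict (unpair-sorted (Linked.map⁺ (Linked.map s≤s lβ)) (Linked.map <⇒≤ lS)) ,
  addStaircase-positive (unpair-All (All.map⁺ (All.universal (λ _ → s≤s z≤n) β)) pS) ,
  (begin
    length (addStaircase (unpair (map suc β) S))  ≡⟨ length-addStaircase (unpair (map suc β) S) ⟩
    length (unpair (map suc β) S)                ≡⟨ unpair-length (map suc β) S ⟩
    length (map suc β) + length (map suc β) + length S ≡⟨ cong (λ n → n + n + length S) (length-map suc β) ⟩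
    length β + length β + length S ∎) ,
  trans (oddSeqCount-addStaircase (unpair (map suc β) S)) (cong (length ∘ proj₂) (pairUp∘unpair (Linked.map⁺ (Linked.map s≤s lβ)) lS))

sum-joinDistinct : ∀ β S → sum (joinDistinct β S) ≡ triangle (length β + length β + length S) + ((sum β + length β) + (sum β + length β) + sum S)
sum-joinDistinct β S = begin
  sum (addStaircase ν)                                    ≡⟨ sum-addStaircase ν ⟩
  sum ν + triangle (length ν)                             ≡⟨ +-comm (sum ν) (triangle (length ν)) ⟩
  triangle (length ν) + sum ν                             ≡⟨ cong₂ _+_ (cong triangle (trans (unpair-length (map suc β) S) (cong (λ n → n + n + length S) (length-map suc β))))
                                                                     (trans (unpair-sum (map suc β) S) (cong (λ s → s + s + sum S) (sum-map-suc β))) ⟩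
  triangle (length β + length β + length S) + ((sum β + length β) + (sum β + length β) + sum S) ∎
  where ν = unpair (map suc β) S

splitDistinct-valid : ∀ μ → Linked _>_ μ → All (1 ≤_) μ →
  Linked _≥_ (proj₁ (splitDistinct μ)) × Linked _>_ (proj₂ (splitDistinct μ)) × All (1 ≤_) (proj₂ (splitDistinct μ))
splitDistinct-valid μ lμ pμ =
  let (lρ , lS) = pairUp-sorted (removeStaircase-sorted lμ) in
  Linked.map⁺ (Linked.map pred-mono-≤ lρ) , lS , proj₂ (pairUp-All (removeStaircase-positive lμ pμ))

splitDistinct∘joinDistinct : ∀ {β S} → Linked _≥_ β → Linked _>_ S → splitDistinct (joinDistinct β S) ≡ (β , S)
splitDistinct∘joinDistinct {β} {S} lβ lS = begin
  Prod.map₁ (map pred) (pairUp (removeStaircase (addStaircase (unpair (map suc β) S))))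
    ≡⟨ cong (λ ν → Prod.map₁ (map pred) (pairUp ν)) (removeStaircase∘addStaircase (unpair (map suc β) S)) ⟩
  Prod.map₁ (map pred) (pairUp (unpair (map suc β) S))
    ≡⟨ cong (Prod.map₁ (map pred)) (pairUp∘unpair (Linked.map⁺ (Linked.map s≤s lβ)) lS) ⟩
  (map pred (map suc β) , S)
    ≡⟨ cong (_, S) (map-pred∘map-suc β) ⟩
  (β , S) ∎

joinDistinct∘splitDistinct : ∀ {μ} → Linked _>_ μ → All (1 ≤_) μ → uncurry joinDistinct (splitDistinct μ) ≡ μ
joinDistinct∘splitDistinct {μ} lμ pμ =
  let ν = removeStaircase μ; ρ = proj₁ (pairUp ν); S = proj₂ (pairUp ν) in begin
  addStaircase (unpair (map suc (map pred ρ)) S)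
    ≡⟨ cong (λ ρ′ → addStaircase (unpair ρ′ S)) (map-suc∘map-pred (proj₁ (pairUp-All (removeStaircase-positive lμ pμ)))) ⟩
  addStaircase (uncurry unpair (pairUp ν))
    ≡⟨ cong addStaircase (unpair∘pairUp (removeStaircase-sorted lμ)) ⟩
  addStaircase (removeStaircase μ)
    ≡⟨ addStaircase∘removeStaircase μ lμ ⟩
  μ ∎

assemble : ℕ → (List ℕ × List ℕ) × List ℕ → List ℕ
assemble M ((τ , β) , Γ) = joinDistinct β (joinSingletons M τ Γ)

disassemble : List ℕ → (List ℕ × List ℕ) × List ℕ
disassemble μ = Prod.map₁ (_, proj₁ (splitDistinct μ)) (splitSingletons (proj₂ (splitDistinct μ)))

-- The size of assemble M ((τ , β) , Γ) when β has j parts and |τ| + |β| = s.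
weight : ℕ → ℕ → ℕ → ℕ → List ℕ → ℕ
weight j M m s Γ = triangle (j + j + (M + m)) + (j + j) + triangle (M + m) + (M + m) + (s + s) + (sum Γ + sum Γ) + length Γ

DistinctWith : ℕ → ℕ → ℕ → List ℕ → Set
DistinctWith n L s μ = IsDistinctPartition n μ × length μ ≡ L × oddSeqCount μ ≡ s

doubled-length : ∀ {k M m} → m ≤ M → m ≤ k → k ∸ m + (k ∸ m) + (M + m) ≡ k + k + (M ∸ m)
doubled-length {k} {M} {m} m≤M m≤k = begin
  k ∸ m + (k ∸ m) + (M + m)              ≡⟨ cong (λ M′ → k ∸ m + (k ∸ m) + (M′ + m)) (sym (m+[n∸m]≡n m≤M)) ⟩
  k ∸ m + (k ∸ m) + (m + (M ∸ m) + m)    ≡⟨ solve 3 (λ i d m → i :+ i :+ (m :+ d :+ m) := i :+ m :+ (i :+ m) :+ d) refl (k ∸ m) (M ∸ m) m ⟩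
  k ∸ m + m + (k ∸ m + m) + (M ∸ m)      ≡⟨ cong (λ k′ → k′ + k′ + (M ∸ m)) (m∸n+n≡m m≤k) ⟩
  k + k + (M ∸ m) ∎

halved-length : ∀ {j k M m} → m ≤ M → j + j + (M + m) ≡ k + k + (M ∸ m) → m ≤ k × j ≡ k ∸ m
halved-length {j} {k} {M} {m} m≤M eq = subst (m ≤_) j+m≡k (m≤n+m m j) , trans (sym (m+n∸n≡m j m)) (cong (_∸ m) j+m≡k)
  where
  j+m≡k : j + m ≡ k
  j+m≡k = *-cancelˡ-≡ (j + m) k 2 (+-cancelʳ-≡ (M ∸ m) _ _ (begin
    2 * (j + m) + (M ∸ m)          ≡⟨ solve 3 (λ j m d → con 2 :* (j :+ m) :+ d := j :+ j :+ (m :+ d :+ m)) refl j m (M ∸ m) ⟩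
    j + j + (m + (M ∸ m) + m)      ≡⟨ cong (λ M′ → j + j + (M′ + m)) (m+[n∸m]≡n m≤M) ⟩
    j + j + (M + m)                ≡⟨ eq ⟩
    k + k + (M ∸ m)                ≡⟨ cong (_+ (M ∸ m)) (solve 1 (λ k → k :+ k := con 2 :* k) refl k) ⟩
    2 * k + (M ∸ m) ∎))

module _ {M m : ℕ} (m≤M : m ≤ M) (M≤1+m : M ≤ suc m) where

  private
    balanced : ∀ τ Γ → length τ ≡ m → Balanced (compress M Γ) (differences τ)
    balanced τ Γ τ≡m rewrite length-compress M Γ | length-differences τ | τ≡m = m≤M , M≤1+m

  joinSingletons-valid : ∀ τ Γ → length τ ≡ m →
    Linked _>_ (joinSingletons M τ Γ) × All (1 ≤_) (joinSingletons M τ Γ) × length (joinSingletons M τ Γ) ≡ M + m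
  joinSingletons-valid τ Γ τ≡m = let g = interleave (compress M Γ) (differences τ) in
    strictOfGaps-strict g , strictOfGaps-positive g ,
    (begin
      length (strictOfGaps g)                               ≡⟨ length-strictOfGaps g ⟩
      length g                                              ≡⟨ length-interleave (compress M Γ) (differences τ) (balanced τ Γ τ≡m) ⟩
      length (compress M Γ) + length (differences τ)        ≡⟨ cong₂ _+_ (length-compress M Γ) (trans (length-differences τ) τ≡m) ⟩
      M + m ∎)

  splitSingletons-valid : ∀ S → length S ≡ M + m →
    Linked _≥_ (proj₁ (splitSingletons S)) × length (proj₁ (splitSingletons S)) ≡ m × PartsBelow M (proj₂ (splitSingletons S))
  splitSingletons-valid S S≡M+m with length-deinterleave M m (gapsOfStrict S) m≤M M≤1+m (trans (length-gapsOfStrict S) S≡M+m)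
  ... | u≡M , v≡m =
    let (u , v) = deinterleave (gapsOfStrict S) in
    suffixSums-sorted v , trans (length-suffixSums v) v≡m ,
    expand-sorted u , subst (λ n → All (_< n) (expand u)) u≡M (expand-bounded u)

  splitSingletons∘joinSingletons : ∀ τ Γ → Linked _≥_ τ → length τ ≡ m → PartsBelow M Γ →
    splitSingletons (joinSingletons M τ Γ) ≡ (τ , Γ)
  splitSingletons∘joinSingletons τ Γ lτ τ≡m (lΓ , Γ<M)
    rewrite gapsOfStrict∘strictOfGaps (interleave (compress M Γ) (differences τ))
          | deinterleave∘interleave (compress M Γ) (differences τ) (balanced τ Γ τ≡m)
          | suffixSums∘differences lτ | expand∘compress M lΓ Γ<M = refl

  joinSingletons∘splitSingletons : ∀ S → Linked _>_ S → All (1 ≤_) S → length S ≡ M + m →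
    uncurry (joinSingletons M) (splitSingletons S) ≡ S
  joinSingletons∘splitSingletons S lS pS S≡M+m with length-deinterleave M m (gapsOfStrict S) m≤M M≤1+m (trans (length-gapsOfStrict S) S≡M+m)
  ... | u≡M , _ = let (u , v) = deinterleave (gapsOfStrict S) in begin
    strictOfGaps (interleave (compress M (expand u)) (differences (suffixSums v)))
      ≡⟨ cong₂ (λ u′ v′ → strictOfGaps (interleave u′ v′)) (subst (λ n → compress n (expand u) ≡ u) u≡M (compress∘expand u)) (differences∘suffixSums v) ⟩
    strictOfGaps (interleave u v)
      ≡⟨ cong strictOfGaps (interleave∘deinterleave (gapsOfStrict S)) ⟩
    strictOfGaps (gapsOfStrict S)
      ≡⟨ strictOfGaps∘gapsOfStrict lS pS ⟩
    S ∎

  sum-joinSingletons : ∀ τ Γ → Linked _≥_ τ → length τ ≡ m → PartsBelow M Γ →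
    sum (joinSingletons M τ Γ) ≡ triangle (M + m) + (M + m) + (sum τ + sum τ) + (sum Γ + sum Γ) + length Γ
  sum-joinSingletons τ Γ lτ τ≡m (lΓ , Γ<M) =
    let u = compress M Γ; v = differences τ; g = interleave u v
        g≡M+m = trans (length-interleave u v (balanced τ Γ τ≡m)) (cong₂ _+_ (length-compress M Γ) (trans (length-differences τ) τ≡m))
        u-sum : sum u ≡ length Γ
        u-sum = trans (sym (length-expand u)) (cong length (expand∘compress M lΓ Γ<M))
        u-weight : sum (suffixSums u) ≡ sum Γ + length Γ
        u-weight = trans (sym (sum-expand u)) (cong₂ _+_ (cong sum (expand∘compress M lΓ Γ<M)) u-sum)
        v-weight : sum (suffixSums v) ≡ sum τ
        v-weight = cong sum (suffixSums∘differences lτ)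
        g-weight : sum (suffixSums g) + length Γ ≡ (sum Γ + length Γ + (sum Γ + length Γ)) + (sum τ + sum τ)
        g-weight = begin
          sum (suffixSums g) + length Γ  ≡⟨ cong (sum (suffixSums g) +_) (sym u-sum) ⟩
          sum (suffixSums g) + sum u     ≡⟨ sum-suffixSums-interleave u v (balanced τ Γ τ≡m) ⟩
          (sum (suffixSums u) + sum (suffixSums u)) + (sum (suffixSums v) + sum (suffixSums v))
                                         ≡⟨ cong₂ (λ a b → (a + a) + (b + b)) u-weight v-weight ⟩
          (sum Γ + length Γ + (sum Γ + length Γ)) + (sum τ + sum τ) ∎
    in begin
    sum (strictOfGaps g)
      ≡⟨ sum-strictOfGaps g ⟩
    sum (suffixSums g) + length g + triangle (length g)
      ≡⟨ cong (λ n → sum (suffixSums g) + n + triangle n) g≡M+m ⟩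
    sum (suffixSums g) + (M + m) + triangle (M + m)
      ≡⟨ cong (λ w → w + (M + m) + triangle (M + m)) (+-cancelʳ-≡ (length Γ) _ _ (trans g-weight
           (solve 3 (λ s n t → s :+ n :+ (s :+ n) :+ (t :+ t) := t :+ t :+ (s :+ s) :+ n :+ n) refl (sum Γ) (length Γ) (sum τ)))) ⟩
    sum τ + sum τ + (sum Γ + sum Γ) + length Γ + (M + m) + triangle (M + m)
      ≡⟨ solve 5 (λ a b c k t → a :+ b :+ c :+ k :+ t := t :+ k :+ a :+ b :+ c) refl (sum τ + sum τ) (sum Γ + sum Γ) (length Γ) (M + m) (triangle (M + m)) ⟩
    triangle (M + m) + (M + m) + (sum τ + sum τ) + (sum Γ + sum Γ) + length Γ ∎

  sum-assemble : ∀ τ β Γ → Linked _≥_ τ → length τ ≡ m → PartsBelow M Γ →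
    sum (assemble M ((τ , β) , Γ)) ≡ weight (length β) M m (sum τ + sum β) Γ
  sum-assemble τ β Γ lτ τ≡m pΓ = let S = joinSingletons M τ Γ; j = length β in begin
    sum (joinDistinct β S)
      ≡⟨ sum-joinDistinct β S ⟩
    triangle (j + j + length S) + ((sum β + j) + (sum β + j) + sum S)
      ≡⟨ cong₂ (λ n s → triangle (j + j + n) + ((sum β + j) + (sum β + j) + s))
               (proj₂ (proj₂ (joinSingletons-valid τ Γ τ≡m))) (sum-joinSingletons τ Γ lτ τ≡m pΓ) ⟩
    triangle (j + j + (M + m)) + ((sum β + j) + (sum β + j) + (triangle (M + m) + (M + m) + (sum τ + sum τ) + (sum Γ + sum Γ) + length Γ))
      ≡⟨ solve 8 (λ T b j U K t g l → T :+ ((b :+ j) :+ (b :+ j) :+ (U :+ K :+ (t :+ t) :+ g :+ l))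
                                    := T :+ (j :+ j) :+ U :+ K :+ ((t :+ b) :+ (t :+ b)) :+ g :+ l)
               refl (triangle (j + j + (M + m))) (sum β) j (triangle (M + m)) (M + m) (sum τ) (sum Γ + sum Γ) (length Γ) ⟩
    weight j M m (sum τ + sum β) Γ ∎

  assemble-valid : ∀ τ β Γ → Linked _≥_ τ → length τ ≡ m → Linked _≥_ β → let μ = assemble M ((τ , β) , Γ) in
    Linked _>_ μ × All (1 ≤_) μ × length μ ≡ length β + length β + (M + m) × oddSeqCount μ ≡ M + m
  assemble-valid τ β Γ lτ τ≡m lβ =
    let (lS , pS , S≡M+m) = joinSingletons-valid τ Γ τ≡m
        (lμ , pμ , μ≡ , odd≡) = joinDistinct-valid β (joinSingletons M τ Γ) lβ lS pS in
    lμ , pμ , trans μ≡ (cong (λ n → length β + length β + n) S≡M+m) , trans odd≡ S≡M+m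

  disassemble∘assemble : ∀ τ β Γ → Linked _≥_ τ → length τ ≡ m → Linked _≥_ β → PartsBelow M Γ →
    disassemble (assemble M ((τ , β) , Γ)) ≡ ((τ , β) , Γ)
  disassemble∘assemble τ β Γ lτ τ≡m lβ pΓ = begin
    Prod.map₁ (_, proj₁ (splitDistinct μ)) (splitSingletons (proj₂ (splitDistinct μ)))
      ≡⟨ cong (λ p → Prod.map₁ (_, proj₁ p) (splitSingletons (proj₂ p))) (splitDistinct∘joinDistinct lβ (proj₁ (joinSingletons-valid τ Γ τ≡m))) ⟩
    Prod.map₁ (_, β) (splitSingletons (joinSingletons M τ Γ))
      ≡⟨ cong (Prod.map₁ (_, β)) (splitSingletons∘joinSingletons τ Γ lτ τ≡m pΓ) ⟩
    ((τ , β) , Γ) ∎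
    where μ = assemble M ((τ , β) , Γ)

  module _ {μ} (lμ : Linked _>_ μ) (pμ : All (1 ≤_) μ) (odd≡ : oddSeqCount μ ≡ M + m) where
    private
      β = proj₁ (splitDistinct μ)
      S = proj₂ (splitDistinct μ)
      split-valid = splitDistinct-valid μ lμ pμ
      S≡M+m : length S ≡ M + m
      S≡M+m = let (lβ , lS , pS) = split-valid; (_ , _ , _ , oddS≡) = joinDistinct-valid β S lβ lS pS in
        trans (sym oddS≡) (trans (cong oddSeqCount (joinDistinct∘splitDistinct lμ pμ)) odd≡)

    disassemble-valid : let ((τ , β) , Γ) = disassemble μ in Linked _≥_ τ × length τ ≡ m × Linked _≥_ β × PartsBelow M Γ
    disassemble-valid = let (lτ , τ≡m , pΓ) = splitSingletons-valid S S≡M+m in lτ , τ≡m , proj₁ split-valid , pΓ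

    assemble∘disassemble : assemble M (disassemble μ) ≡ μ
    assemble∘disassemble = let (_ , lS , pS) = split-valid in
      trans (cong (joinDistinct β) (joinSingletons∘splitSingletons S lS pS S≡M+m)) (joinDistinct∘splitDistinct lμ pμ)

  distinctStage : ∀ {n k L s} → M + m ≡ s → k + k + (M ∸ m) ≡ L →
    SubsetInverse (Weighted (ShuffleOutput k m) (PartsBelow M) (weight (k ∸ m) M m) n) (DistinctWith n L s)
  distinctStage {n} {k} {L} {s} M+m≡s L≡ = record
    { to      = assemble M
    ; from    = disassemble
    ; to-∈    = λ { {(τ , β) , Γ} ((m≤k , lτ , τ≡m , lβ , β≡j) , pΓ , w≡n) →
                    let (lμ , pμ , μ≡ , odd≡) = assemble-valid τ β Γ lτ τ≡m lβ in
                    (lμ , pμ , trans (sum-assemble τ β Γ lτ τ≡m pΓ) (trans (cong (λ j → weight j M m (sum τ + sum β) Γ) β≡j) w≡n)) ,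
                    trans μ≡ (trans (cong (λ j → j + j + (M + m)) β≡j) (trans (doubled-length m≤M m≤k) L≡)) ,
                    trans odd≡ M+m≡s }
    ; from-∈  = λ { {μ} ((lμ , pμ , μ≡n) , μ≡L , odd≡s) → from-∈ lμ pμ μ≡n μ≡L (trans odd≡s (sym M+m≡s)) }
    ; from∘to = λ { {(τ , β) , Γ} ((_ , lτ , τ≡m , lβ , _) , pΓ , _) → disassemble∘assemble τ β Γ lτ τ≡m lβ pΓ }
    ; to∘from = λ { {μ} ((lμ , pμ , _) , _ , odd≡s) → assemble∘disassemble lμ pμ (trans odd≡s (sym M+m≡s)) }
    }
    where
    from-∈ : ∀ {μ} → Linked _>_ μ → All (1 ≤_) μ → sum μ ≡ n → length μ ≡ L → oddSeqCount μ ≡ M + m →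
      Weighted (ShuffleOutput k m) (PartsBelow M) (weight (k ∸ m) M m) n (disassemble μ)
    from-∈ {μ} lμ pμ μ≡n μ≡L odd≡ =
      let ((τ , β) , Γ) = disassemble μ
          (lτ , τ≡m , lβ , pΓ) = disassemble-valid lμ pμ odd≡
          μ≡ = assemble∘disassemble lμ pμ odd≡
          (_ , _ , len≡ , _) = assemble-valid τ β Γ lτ τ≡m lβ
          (m≤k , β≡j) = halved-length m≤M (trans (sym len≡) (trans (cong length μ≡) (trans μ≡L (sym L≡)))) in
      (m≤k , lτ , τ≡m , lβ , β≡j) , pΓ ,
      (begin
        weight (k ∸ m) M m (sum τ + sum β) Γ     ≡⟨ cong (λ j → weight j M m (sum τ + sum β) Γ) (sym β≡j) ⟩
        weight (length β) M m (sum τ + sum β) Γ  ≡⟨ sym (sum-assemble τ β Γ lτ τ≡m pΓ) ⟩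
        sum (assemble M (disassemble μ))         ≡⟨ cong sum μ≡ ⟩
        sum μ                                    ≡⟨ μ≡n ⟩
        n ∎)

-- Partitions into odd parts and 2-modular Durfee squares

odd : ℕ → ℕ
odd a = suc (a + a)

odd-mono-≤ : ∀ {a b} → a ≤ b → odd a ≤ odd b
odd-mono-≤ a≤b = s≤s (+-mono-≤ a≤b a≤b)

odd-mono-< : ∀ {a b} → a < b → odd a < odd b
odd-mono-< a<b = s≤s (+-mono-< a<b a<b)

odd-cancel-≤ : ∀ {a b} → odd a ≤ odd b → a ≤ b
odd-cancel-≤ {a} {b} oa≤ob with a ≤? b
... | yes a≤b = a≤b
... | no a≰b = ⊥-elim (<⇒≱ (odd-mono-< (≰⇒> a≰b)) oa≤ob)

odd-cancel-< : ∀ {a b} → odd a < odd b → a < b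
odd-cancel-< {a} {b} oa<ob with a <? b
... | yes a<b = a<b
... | no a≮b = ⊥-elim (<⇒≱ oa<ob (odd-mono-≤ (≮⇒≥ a≮b)))

odd-injective : ∀ {a b} → odd a ≡ odd b → a ≡ b
odd-injective eq = ≤-antisym (odd-cancel-≤ (≤-reflexive eq)) (odd-cancel-≤ (≤-reflexive (sym eq)))

odd-%2 : ∀ a → odd a % 2 ≡ 1
odd-%2 a = trans (cong (_% 2) (solve 1 (λ a → con 1 :+ (a :+ a) := con 1 :+ a :* con 2) refl a)) ([m+kn]%n≡m%n 1 a 2)

⌊odd/2⌋ : ∀ a → ⌊ odd a /2⌋ ≡ a
⌊odd/2⌋ zero = refl
⌊odd/2⌋ (suc a) rewrite +-suc a a = cong suc (⌊odd/2⌋ a)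

odd-⌊/2⌋ : ∀ y → y % 2 ≡ 1 → odd ⌊ y /2⌋ ≡ y
odd-⌊/2⌋ (suc zero) _ = refl
odd-⌊/2⌋ (suc (suc y)) y%2 rewrite +-suc ⌊ y /2⌋ ⌊ y /2⌋ =
  cong (suc ∘ suc) (odd-⌊/2⌋ y (trans (sym (trans (cong (_% 2) (+-comm 2 y)) ([m+n]%n≡m%n y 2))) y%2))

map-⌊/2⌋-odd : ∀ a → map ⌊_/2⌋ (map odd a) ≡ a
map-⌊/2⌋-odd a = trans (sym (map-∘ a)) (map-id-local (All.universal ⌊odd/2⌋ a))

map-odd-⌊/2⌋ : ∀ {l} → All (λ y → y % 2 ≡ 1) l → map odd (map ⌊_/2⌋ l) ≡ l
map-odd-⌊/2⌋ {l} odds = trans (sym (map-∘ l)) (map-id-local (All.map (odd-⌊/2⌋ _) odds))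

sum-map-odd : ∀ a → sum (map odd a) ≡ sum a + sum a + length a
sum-map-odd [] = refl
sum-map-odd (x ∷ a) rewrite sum-map-odd a =
  solve 3 (λ x s n → con 1 :+ (x :+ x) :+ (s :+ s :+ n) := x :+ s :+ (x :+ s) :+ (con 1 :+ n)) refl x (sum a) (length a)

odd-partition : ∀ {a} → Linked _≥_ a → IsOddPartition (sum (map odd a)) (map odd a)
odd-partition {a} lk = Linked.map⁺ (Linked.map odd-mono-≤ lk) , All.map⁺ (All.universal odd-%2 a) , refl

halves-sorted : ∀ {l} → Linked _≥_ l → Linked _≥_ (map ⌊_/2⌋ l)
halves-sorted lk = Linked.map⁺ (Linked.map ⌊n/2⌋-mono lk)

map-+-lower : ∀ c l → All (c ≤_) (map (_+ c) l)
map-+-lower c l = All.map⁺ (All.universal (λ y → m≤n+m c y) l)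

2*suc∸1≡odd : ∀ i → 2 * suc i ∸ 1 ≡ odd i
2*suc∸1≡odd i = trans (cong (i +_) (+-identityʳ (suc i))) (+-suc i i)

2*+1≡odd : ∀ m → 2 * m + 1 ≡ odd m
2*+1≡odd m = trans (+-comm (2 * m) 1) (cong (λ n → suc (m + n)) (+-identityʳ m))

lookup0-++ˡ : ∀ P Q {i} → i < length P → lookup0 (P ++ Q) i ≡ lookup0 P i
lookup0-++ˡ (p ∷ P) Q {zero} _ = refl
lookup0-++ˡ (p ∷ P) Q {suc i} (s≤s i<P) = lookup0-++ˡ P Q i<P

lookup0-++ʳ : ∀ P Q j → lookup0 (P ++ Q) (length P + j) ≡ lookup0 Q j
lookup0-++ʳ [] Q j = refl
lookup0-++ʳ (p ∷ P) Q j = lookup0-++ʳ P Q j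

lookup0-drop : ∀ l d j → lookup0 (drop d l) j ≡ lookup0 l (d + j)
lookup0-drop [] zero j = refl
lookup0-drop [] (suc d) zero = refl
lookup0-drop [] (suc d) (suc j) = refl
lookup0-drop (x ∷ l) zero j = refl
lookup0-drop (x ∷ l) (suc d) j = lookup0-drop l d j

lookup0-map : ∀ f l {i} → i < length l → lookup0 (map f l) i ≡ f (lookup0 l i)
lookup0-map f (x ∷ l) {zero} _ = refl
lookup0-map f (x ∷ l) {suc i} (s≤s i<l) = lookup0-map f l i<l

lookup0-All : ∀ {P : ℕ → Set} {l i} → All P l → i < length l → P (lookup0 l i)
lookup0-All {i = zero} (p ∷ _) _ = p
lookup0-All {i = suc i} (_ ∷ ps) (s≤s i<l) = lookup0-All ps i<l

lookup0-All< : ∀ {c l} i → All (_< suc c) l → lookup0 l i < suc c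
lookup0-All< _ [] = s≤s z≤n
lookup0-All< zero (p ∷ _) = p
lookup0-All< (suc i) (_ ∷ ps) = lookup0-All< i ps

lookup0-map-odd : ∀ a i → 1 ≤ lookup0 (map odd a) i → i < length a × lookup0 (map odd a) i ≡ odd (lookup0 a i)
lookup0-map-odd (x ∷ a) zero _ = s≤s z≤n , refl
lookup0-map-odd (x ∷ a) (suc i) pos = Prod.map₁ s≤s (lookup0-map-odd a i pos)

lookup0-map-++ˡ : ∀ (f : ℕ → ℕ) P Q {i} → i < length P → lookup0 (map f (P ++ Q)) i ≡ f (lookup0 P i)
lookup0-map-++ˡ f P Q {i} i<P = begin
  lookup0 (map f (P ++ Q)) i       ≡⟨ cong (λ l → lookup0 l i) (map-++ f P Q) ⟩
  lookup0 (map f P ++ map f Q) i   ≡⟨ lookup0-++ˡ (map f P) (map f Q) (subst (i <_) (sym (length-map f P)) i<P) ⟩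
  lookup0 (map f P) i              ≡⟨ lookup0-map f P i<P ⟩
  f (lookup0 P i)                  ∎

lookup0-map-++ʳ : ∀ (f : ℕ → ℕ) P Q {i} → length P ≤ i → lookup0 (map f (P ++ Q)) i ≡ lookup0 (map f Q) (i ∸ length P)
lookup0-map-++ʳ f P Q {i} P≤i = begin
  lookup0 (map f (P ++ Q)) i                        ≡⟨ cong (λ l → lookup0 l i) (map-++ f P Q) ⟩
  lookup0 (map f P ++ map f Q) i                    ≡⟨ cong (lookup0 (map f P ++ map f Q)) (sym (m+[n∸m]≡n P≤i)) ⟩
  lookup0 (map f P ++ map f Q) (length P + (i ∸ length P)) ≡⟨ cong (λ n → lookup0 (map f P ++ map f Q) (n + (i ∸ length P))) (sym (length-map f P)) ⟩
  lookup0 (map f P ++ map f Q) (length (map f P) + (i ∸ length P)) ≡⟨ lookup0-++ʳ (map f P) (map f Q) (i ∸ length P) ⟩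
  lookup0 (map f Q) (i ∸ length P)                  ∎

lookup0-map-drop : ∀ (f : ℕ → ℕ) a k j → lookup0 (map f a) (k + j) ≡ lookup0 (map f (drop k a)) j
lookup0-map-drop f a k j = trans (sym (lookup0-drop (map f a) k j)) (cong (λ l → lookup0 l j) (drop-map k a))

part-suc : ∀ l k j → part l (k + suc j) ≡ lookup0 l (k + j)
part-suc l k j = cong (λ n → lookup0 l (n ∸ 1)) (+-suc k j)

odd-lower-bound : ∀ {c} P Q {i} → All (c ≤_) P → i < length P → odd c ≤ lookup0 (map odd (P ++ Q)) i
odd-lower-bound {c} P Q c≤P i<P = subst (odd c ≤_) (sym (lookup0-map-++ˡ odd P Q i<P)) (odd-mono-≤ (lookup0-All c≤P i<P))

odd-upper-bound : ∀ {c} P Q {i} → All (_< c) Q → length P ≤ i → lookup0 (map odd (P ++ Q)) i < odd c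
odd-upper-bound {c} P Q {i} Q<c P≤i =
  subst (_< odd c) (sym (lookup0-map-++ʳ odd P Q P≤i)) (lookup0-All< (i ∸ length P) (All.map⁺ (All.map odd-mono-< Q<c)))

sorted-take-lower : ∀ {c a} i → Linked _≥_ a → c ≤ lookup0 a i → i < length a → All (c ≤_) (take (suc i) a)
sorted-take-lower {a = x ∷ a} zero _ c≤x _ = c≤x ∷ []
sorted-take-lower {a = x ∷ a} (suc i) lk c≤aᵢ (s≤s i<a) =
  ≤-trans c≤aᵢ (lookup0-All (≥-head lk) i<a) ∷ sorted-take-lower i (Linked.tail lk) c≤aᵢ i<a

sorted-take-lower′ : ∀ {c a} i → Linked _≥_ a → c ≤ lookup0 a i → i < length a → All (c ≤_) (take i a)
sorted-take-lower′ {a = a} i lk c≤aᵢ i<a =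
  subst (All _) (trans (take-take i (suc i) a) (cong (λ n → take n a) (m≤n⇒m⊓n≡m (n≤1+n i)))) (All.take⁺ i (sorted-take-lower i lk c≤aᵢ i<a))

sorted-drop-upper : ∀ {c a} i → Linked _≥_ a → lookup0 (map odd a) i < odd c → All (_< c) (drop i a)
sorted-drop-upper {a = []} zero _ _ = []
sorted-drop-upper {a = []} (suc i) _ _ = []
sorted-drop-upper {a = x ∷ a} zero lk ox<oc = x<c ∷ All.map (λ y≤x → ≤-<-trans y≤x x<c) (≥-head lk)
  where x<c = odd-cancel-< ox<oc
sorted-drop-upper {a = x ∷ a} (suc i) lk bound = sorted-drop-upper i (Linked.tail lk) bound

odd-lookup-lower : ∀ {c a} i → Linked _≥_ a → odd c ≤ lookup0 (map odd a) i → i < length a × All (c ≤_) (take (suc i) a)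
odd-lookup-lower {c} {a} i lk oc≤ =
  let (i<a , eq) = lookup0-map-odd a i (≤-trans (s≤s z≤n) oc≤) in
  i<a , sorted-take-lower i lk (odd-cancel-≤ (subst (odd c ≤_) eq oc≤)) i<a

durfeeI-of-split : ∀ {k′} P Q → length P ≡ suc k′ → All (suc k′ ≤_) P → All (_< suc k′) Q →
  IsDur2 (map odd (P ++ Q)) (suc k′) × TypeI (map odd (P ++ Q)) (suc k′)
durfeeI-of-split {k′} P Q P≡k k≤P Q<k = (<⇒≤ typeI , beyond) , typeI
  where
  typeI : 2 * suc k′ ∸ 1 < lookup0 (map odd (P ++ Q)) k′
  typeI = subst (_< lookup0 (map odd (P ++ Q)) k′) (sym (2*suc∸1≡odd k′))
    (<-≤-trans (odd-mono-< ≤-refl) (odd-lower-bound P Q k≤P (subst (k′ <_) (sym P≡k) ≤-refl)))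
  beyond : ∀ i → suc k′ < i → part (map odd (P ++ Q)) i < 2 * i ∸ 1
  beyond (suc i) (s≤s k≤i) = subst (lookup0 (map odd (P ++ Q)) i <_) (sym (2*suc∸1≡odd i))
    (<-≤-trans (odd-upper-bound P Q Q<k (subst (_≤ i) (sym P≡k) k≤i)) (odd-mono-≤ k≤i))

subDurfeeI-of-split : ∀ {k m} P Q → length P ≡ k + m → All (pred m ≤_) P → All (_< m) Q → IsSubDurI (map odd (P ++ Q)) k m
subDurfeeI-of-split {k} {m} P Q P≡k+m m≤P Q<m = at-m m P≡k+m m≤P , beyond
  where
  at-m : ∀ m → length P ≡ k + m → All (pred m ≤_) P → m ≡ 0 ⊎ 2 * m ∸ 1 ≤ part (map odd (P ++ Q)) (k + m)
  at-m zero _ _ = inj₁ refl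
  at-m (suc m′) P≡ m′≤P = inj₂ (subst₂ _≤_ (sym (2*suc∸1≡odd m′)) (sym (part-suc (map odd (P ++ Q)) k m′))
    (odd-lower-bound P Q m′≤P (subst (k + m′ <_) (sym P≡) (+-monoʳ-< k (n<1+n m′)))))
  beyond : ∀ j → m < j → part (map odd (P ++ Q)) (k + j) < 2 * j ∸ 1
  beyond (suc j) (s≤s m≤j) = subst₂ _<_ (sym (part-suc (map odd (P ++ Q)) k j)) (sym (2*suc∸1≡odd j))
    (<-≤-trans (odd-upper-bound P Q Q<m (subst (_≤ k + j) (sym P≡k+m) (+-monoʳ-≤ k m≤j))) (odd-mono-≤ m≤j))

durfeeII-of-split : ∀ {K} P Q → length P ≡ K → All (K ≤_) P → All (_≤ K) Q →
  IsDur2 (map odd (P ++ K ∷ Q)) (suc K) × TypeII (map odd (P ++ K ∷ Q)) (suc K)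
durfeeII-of-split {K} P Q P≡K K≤P Q≤K = (≤-reflexive (sym typeII) , beyond) , typeII
  where
  P′ = P ++ K ∷ []
  reassoc : P ++ K ∷ Q ≡ P′ ++ Q
  reassoc = sym (++-assoc P (K ∷ []) Q)
  typeII : lookup0 (map odd (P ++ K ∷ Q)) K ≡ 2 * suc K ∸ 1
  typeII = begin
    lookup0 (map odd (P ++ K ∷ Q)) K              ≡⟨ lookup0-map-++ʳ odd P (K ∷ Q) (≤-reflexive P≡K) ⟩
    lookup0 (map odd (K ∷ Q)) (K ∸ length P)      ≡⟨ cong (λ n → lookup0 (map odd (K ∷ Q)) (K ∸ n)) P≡K ⟩
    lookup0 (map odd (K ∷ Q)) (K ∸ K)             ≡⟨ cong (lookup0 (map odd (K ∷ Q))) (n∸n≡0 K) ⟩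
    odd K                                         ≡⟨ sym (2*suc∸1≡odd K) ⟩
    2 * suc K ∸ 1                                 ∎
  beyond : ∀ i → suc K < i → part (map odd (P ++ K ∷ Q)) i < 2 * i ∸ 1
  beyond (suc i) (s≤s K<i) = subst₂ _<_ (cong (λ l → lookup0 (map odd l) i) (sym reassoc)) (sym (2*suc∸1≡odd i))
    (<-≤-trans (odd-upper-bound P′ Q (All.map s≤s Q≤K) (subst (_≤ i) (sym P′≡) K<i)) (odd-mono-≤ K<i))
    where
    P′≡ : length P′ ≡ suc K
    P′≡ = trans (length-++ P) (trans (cong (_+ 1) P≡K) (+-comm K 1))

subDurfeeII-of-split : ∀ {k m} P Q → length P ≡ k + m → All (m ≤_) P → All (_< suc m) Q → IsSubDurII (map odd (P ++ Q)) k m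
subDurfeeII-of-split {k} {m} P Q P≡k+m m≤P Q≤m = at-m m P≡k+m m≤P , beyond
  where
  at-m : ∀ m → length P ≡ k + m → All (m ≤_) P → m ≡ 0 ⊎ 2 * m + 1 ≤ part (map odd (P ++ Q)) (k + m)
  at-m zero _ _ = inj₁ refl
  at-m (suc m′) P≡ m≤P′ = inj₂ (subst₂ _≤_ (sym (2*+1≡odd (suc m′))) (sym (part-suc (map odd (P ++ Q)) k m′))
    (odd-lower-bound P Q m≤P′ (subst (k + m′ <_) (sym P≡) (+-monoʳ-< k (n<1+n m′)))))
  beyond : ∀ j → m < j → part (map odd (P ++ Q)) (k + j) < 2 * j + 1
  beyond (suc j) (s≤s m≤j) = subst₂ _<_ (sym (part-suc (map odd (P ++ Q)) k j)) (sym (2*+1≡odd (suc j)))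
    (<-≤-trans (odd-upper-bound P Q Q≤m (subst (_≤ k + j) (sym P≡k+m) (+-monoʳ-≤ k m≤j))) (odd-mono-≤ (s≤s m≤j)))

split-of-durfeeI : ∀ {k′ a} → Linked _≥_ a → IsDur2 (map odd a) (suc k′) → TypeI (map odd a) (suc k′) →
  suc k′ ≤ length a × All (suc k′ ≤_) (take (suc k′) a) × All (_< suc k′) (drop (suc k′) a)
split-of-durfeeI {k′} {a} lk (_ , beyond) typeI =
  let typeI′ = subst (_< lookup0 (map odd a) k′) (2*suc∸1≡odd k′) typeI
      (k′<a , eq) = lookup0-map-odd a k′ (≤-trans (s≤s z≤n) typeI′) in
  k′<a , sorted-take-lower k′ lk (odd-cancel-< (subst (odd k′ <_) eq typeI′)) k′<a ,
  sorted-drop-upper (suc k′) lk (subst (lookup0 (map odd a) (suc k′) <_) (2*suc∸1≡odd (suc k′)) (beyond (suc (suc k′)) ≤-refl))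

split-of-subDurfeeI : ∀ {k m a} → Linked _≥_ a → IsSubDurI (map odd a) k m →
  m ≤ length (drop k a) × All (pred m ≤_) (take m (drop k a)) × All (_< m) (drop m (drop k a))
split-of-subDurfeeI {k} {m} {a} lk (at-m , beyond) = Prod.map₂ (_, below) (lower m at-m)
  where
  below : All (_< m) (drop m (drop k a))
  below = subst (All (_< m)) (sym (drop-drop k m a))
    (sorted-drop-upper (k + m) lk (subst₂ _<_ (part-suc (map odd a) k m) (2*suc∸1≡odd m) (beyond (suc m) ≤-refl)))
  lower : ∀ m → m ≡ 0 ⊎ 2 * m ∸ 1 ≤ part (map odd a) (k + m) → m ≤ length (drop k a) × All (pred m ≤_) (take m (drop k a))
  lower zero _ = z≤n , []
  lower (suc m′) (inj₂ bound) = odd-lookup-lower m′ (sorted-drop k lk)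
    (subst₂ _≤_ (2*suc∸1≡odd m′) (trans (part-suc (map odd a) k m′) (lookup0-map-drop odd a k m′)) bound)

split-of-durfeeII : ∀ {K a} → TypeII (map odd a) (suc K) → K < length a × lookup0 a K ≡ K
split-of-durfeeII {K} {a} typeII =
  let typeII′ = trans typeII (2*suc∸1≡odd K)
      (K<a , eq) = lookup0-map-odd a K (subst (1 ≤_) (sym typeII′) (s≤s z≤n)) in
  K<a , odd-injective (trans (sym eq) typeII′)

split-of-subDurfeeII : ∀ {k m a} → Linked _≥_ a → IsSubDurII (map odd a) k m →
  m ≤ length (drop k a) × All (m ≤_) (take m (drop k a)) × All (_< suc m) (drop m (drop k a))
split-of-subDurfeeII {k} {m} {a} lk (at-m , beyond) = Prod.map₂ (_, below) (lower m at-m)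
  where
  below : All (_< suc m) (drop m (drop k a))
  below = subst (All (_< suc m)) (sym (drop-drop k m a))
    (sorted-drop-upper (k + m) lk (subst₂ _<_ (part-suc (map odd a) k m) (2*+1≡odd (suc m)) (beyond (suc m) ≤-refl)))
  lower : ∀ m → m ≡ 0 ⊎ 2 * m + 1 ≤ part (map odd a) (k + m) → m ≤ length (drop k a) × All (m ≤_) (take m (drop k a))
  lower zero _ = z≤n , []
  lower (suc m′) (inj₂ bound) = odd-lookup-lower m′ (sorted-drop k lk)
    (subst₂ _≤_ (2*+1≡odd (suc m′)) (trans (part-suc (map odd a) k m′) (lookup0-map-drop odd a k m′)) bound)

-- Type I

pred-square : ∀ m → m * pred m + m ≡ m * m
pred-square zero = refl
pred-square (suc m) = solve 1 (λ m → (con 1 :+ m) :* m :+ (con 1 :+ m) := (con 1 :+ m) :* (con 1 :+ m)) refl m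

weight-typeI : ∀ j m sr sx Γ → let k = j + m; A = sr + k * k + (sx + m * pred m + sum Γ) in
  weight j m m (sr + sx) Γ ≡ A + A + (k + (m + length Γ))
weight-typeI j m sr sx Γ = +-cancelʳ-≡ (k + m) _ _ (begin
  triangle (j + j + (m + m)) + (j + j) + triangle (m + m) + (m + m) + (s + s) + (g + g) + l + (k + m)
    ≡⟨ cong (λ t → triangle t + (j + j) + triangle (m + m) + (m + m) + (s + s) + (g + g) + l + (k + m))
            (solve 2 (λ j m → j :+ j :+ (m :+ m) := j :+ m :+ (j :+ m)) refl j m) ⟩
  triangle (k + k) + (j + j) + triangle (m + m) + (m + m) + (s + s) + (g + g) + l + (k + m)
    ≡⟨ solve 8 (λ T U j m s g l k → T :+ (j :+ j) :+ U :+ (m :+ m) :+ (s :+ s) :+ (g :+ g) :+ l :+ (k :+ m)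
                                   := (T :+ k) :+ (U :+ m) :+ ((j :+ j) :+ (m :+ m) :+ (s :+ s) :+ (g :+ g) :+ l))
            refl (triangle (k + k)) (triangle (m + m)) j m s g l k ⟩
  (triangle (k + k) + k) + (triangle (m + m) + m) + rest
    ≡⟨ cong₂ (λ a b → a + b + rest) (triangle-double k) (trans (triangle-double m) (cong (λ q → q + q) (sym (pred-square m)))) ⟩
  (k * k + k * k) + ((m * pred m + m) + (m * pred m + m)) + rest
    ≡⟨ solve 7 (λ j m sr sx g l P → ((j :+ m) :* (j :+ m) :+ (j :+ m) :* (j :+ m)) :+ ((P :+ m) :+ (P :+ m))
                                     :+ ((j :+ j) :+ (m :+ m) :+ ((sr :+ sx) :+ (sr :+ sx)) :+ (g :+ g) :+ l)
                                   := (sr :+ (j :+ m) :* (j :+ m) :+ (sx :+ P :+ g)) :+ (sr :+ (j :+ m) :* (j :+ m) :+ (sx :+ P :+ g))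
                                     :+ ((j :+ m) :+ (m :+ l)) :+ ((j :+ m) :+ m))
            refl j m sr sx g l (m * pred m) ⟩
  A + A + (k + (m + l)) + (k + m) ∎)
  where
  k = j + m
  s = sr + sx
  g = sum Γ
  l = length Γ
  A = sr + k * k + (sx + m * pred m + g)
  rest = (j + j) + (m + m) + (s + s) + (g + g) + l

-- Halves: the k rows r + k through the Durfee square, the m rows x + (m − 1) through the
-- sub-Durfee square, then Γ.
oddPartsI : ℕ → ℕ → (List ℕ × List ℕ) × List ℕ → List ℕ
oddPartsI k m ((r , x) , Γ) = map odd (map (_+ k) r ++ map (_+ pred m) x ++ Γ)

durfeeBlocksI : ℕ → ℕ → List ℕ → (List ℕ × List ℕ) × List ℕ
durfeeBlocksI k m l = (map (_∸ k) (take k a) , map (_∸ pred m) (take m (drop k a))) , drop m (drop k a)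
  where a = map ⌊_/2⌋ l

OddTypeI : ℕ → ℕ → ℕ → List ℕ → Set
OddTypeI n k m l = IsOddPartition n l × IsDur2 l k × TypeI l k × IsSubDurI l k m

rows-below-Durfee : ∀ {k m x} → m ≤ k → Linked _≥_ (k ∸ m ∷ x) → length x ≡ m → All (_< k) (map (_+ pred m) x)
rows-below-Durfee {m = zero} {[]} _ _ _ = []
rows-below-Durfee {k} {suc m′} m≤k jx _ = All.map⁺ (All.map (λ {y} y≤ → ≤-<-trans (+-monoˡ-≤ m′ y≤) k∸m+m′<k) (≥-head jx))
  where
  k∸m+m′<k : k ∸ suc m′ + m′ < k
  k∸m+m′<k = subst (k ∸ suc m′ + m′ <_) (m∸n+n≡m m≤k) (+-monoʳ-< (k ∸ suc m′) (n<1+n m′))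

sum-oddPartsI : ∀ k m r x Γ → length r ≡ k → length x ≡ m → let A = sum r + k * k + (sum x + m * pred m + sum Γ) in
  sum (oddPartsI k m ((r , x) , Γ)) ≡ A + A + (k + (m + length Γ))
sum-oddPartsI k m r x Γ r≡k x≡m =
  trans (sum-map-odd (map (_+ k) r ++ map (_+ pred m) x ++ Γ)) (cong₂ (λ s n → s + s + n) sum-L length-L)
  where
  sum-L : sum (map (_+ k) r ++ map (_+ pred m) x ++ Γ) ≡ sum r + k * k + (sum x + m * pred m + sum Γ)
  sum-L = begin
    sum (map (_+ k) r ++ map (_+ pred m) x ++ Γ)
      ≡⟨ trans (sum-++ (map (_+ k) r) _) (cong (sum (map (_+ k) r) +_) (sum-++ (map (_+ pred m) x) Γ)) ⟩
    sum (map (_+ k) r) + (sum (map (_+ pred m) x) + sum Γ)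
      ≡⟨ cong₂ (λ a b → a + (b + sum Γ)) (trans (sum-map-+ k r) (cong (λ n → sum r + n * k) r≡k)) (trans (sum-map-+ (pred m) x) (cong (λ n → sum x + n * pred m) x≡m)) ⟩
    sum r + k * k + (sum x + m * pred m + sum Γ) ∎
  length-L : length (map (_+ k) r ++ map (_+ pred m) x ++ Γ) ≡ k + (m + length Γ)
  length-L = trans (length-++ (map (_+ k) r)) (cong₂ _+_ (trans (length-map (_+ k) r) r≡k)
               (trans (length-++ (map (_+ pred m) x)) (cong (_+ length Γ) (trans (length-map (_+ pred m) x) x≡m))))

oddPartsI-weight : ∀ {k m r x} Γ → ShuffleInput k m (r , x) → sum (oddPartsI k m ((r , x) , Γ)) ≡ weight (k ∸ m) m m (sum r + sum x) Γ
oddPartsI-weight {k} {m} {r} {x} Γ (m≤k , _ , r≡k , _ , x≡m) = begin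
  sum (oddPartsI k m ((r , x) , Γ))          ≡⟨ sum-oddPartsI k m r x Γ r≡k x≡m ⟩
  A k + A k + (k + (m + length Γ))           ≡⟨ cong (λ k → A k + A k + (k + (m + length Γ))) (sym (m∸n+n≡m m≤k)) ⟩
  A (k ∸ m + m) + A (k ∸ m + m) + (k ∸ m + m + (m + length Γ)) ≡⟨ sym (weight-typeI (k ∸ m) m (sum r) (sum x) Γ) ⟩
  weight (k ∸ m) m m (sum r + sum x) Γ       ∎
  where A = λ k → sum r + k * k + (sum x + m * pred m + sum Γ)

oddPartsI-valid : ∀ {k′ m r x Γ} → ShuffleInput (suc k′) m (r , x) → PartsBelow m Γ →
  let l = oddPartsI (suc k′) m ((r , x) , Γ) in IsOddPartition (sum l) l × IsDur2 l (suc k′) × TypeI l (suc k′) × IsSubDurI l (suc k′) m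
oddPartsI-valid {k′} {m} {r} {x} {Γ} (m≤k , lr , r≡k , jx , x≡m) (lΓ , Γ<m) =
  odd-partition sorted , proj₁ durfee , proj₂ durfee , subst (λ L → IsSubDurI (map odd L) k m) (++-assoc R X Γ) subDurfee
  where
  k = suc k′
  R = map (_+ k) r
  X = map (_+ pred m) x
  R≡k = trans (length-map (_+ k) r) r≡k
  X≡m = trans (length-map (_+ pred m) x) x≡m
  XΓ<k : All (_< k) (X ++ Γ)
  XΓ<k = All.++⁺ (rows-below-Durfee m≤k jx x≡m) (All.map (λ y<m → <-≤-trans y<m m≤k) Γ<m)
  sorted : Linked _≥_ (R ++ X ++ Γ)
  sorted = sorted-++ R (X ++ Γ) (Linked.map⁺ (Linked.map (+-monoˡ-≤ k) lr))
             (sorted-++ X Γ (Linked.map⁺ (Linked.map (+-monoˡ-≤ (pred m)) (Linked.tail jx))) lΓ (map-+-lower (pred m) x) (All.map <⇒≤pred Γ<m))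
             (map-+-lower k r) (All.map <⇒≤ XΓ<k)
  durfee = durfeeI-of-split R (X ++ Γ) R≡k (map-+-lower k r) XΓ<k
  subDurfee : IsSubDurI (map odd ((R ++ X) ++ Γ)) k m
  subDurfee = subDurfeeI-of-split (R ++ X) Γ (trans (length-++ R) (cong₂ _+_ R≡k X≡m))
    (All.++⁺ (All.map (λ k≤y → ≤-trans (≤-trans pred[n]≤n m≤k) k≤y) (map-+-lower k r)) (map-+-lower (pred m) x)) Γ<m

durfeeBlocksI∘oddPartsI : ∀ k m r x Γ → length r ≡ k → length x ≡ m → durfeeBlocksI k m (oddPartsI k m ((r , x) , Γ)) ≡ ((r , x) , Γ)
durfeeBlocksI∘oddPartsI k m r x Γ r≡k x≡m
  rewrite map-⌊/2⌋-odd (map (_+ k) r ++ map (_+ pred m) x ++ Γ)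
        | take-++ (map (_+ k) r) (map (_+ pred m) x ++ Γ) (trans (length-map (_+ k) r) r≡k)
        | drop-++ (map (_+ k) r) (map (_+ pred m) x ++ Γ) (trans (length-map (_+ k) r) r≡k)
        | take-++ (map (_+ pred m) x) Γ (trans (length-map (_+ pred m) x) x≡m)
        | drop-++ (map (_+ pred m) x) Γ (trans (length-map (_+ pred m) x) x≡m)
        | map-∸+ k r | map-∸+ (pred m) x = refl

durfeeI-splits : ∀ {n k′ m l} → OddTypeI n (suc k′) m l → let a = map ⌊_/2⌋ l; D = drop (suc k′) a in
  (suc k′ ≤ length a × All (suc k′ ≤_) (take (suc k′) a) × All (_< suc k′) D)
  × (m ≤ length D × All (pred m ≤_) (take m D) × All (_< m) (drop m D))
durfeeI-splits {k′ = k′} {m} ((lk , odds , _) , dur , typeI , sub) =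
  split-of-durfeeI la (subst (λ l → IsDur2 l (suc k′)) eq dur) (subst (λ l → TypeI l (suc k′)) eq typeI) ,
  split-of-subDurfeeI {suc k′} la (subst (λ l → IsSubDurI l (suc k′) m) eq sub)
  where
  la = halves-sorted lk
  eq = sym (map-odd-⌊/2⌋ odds)

subDurfee≤durfee : ∀ {k m D} → m ≤ length D → All (pred m ≤_) (take m D) → All (_< k) D → m ≤ k
subDurfee≤durfee {m = zero} _ _ _ = z≤n
subDurfee≤durfee {m = suc m′} {y ∷ D} _ (m′≤y ∷ _) (y<k ∷ _) = ≤-<-trans m′≤y y<k

durfeeBlocksI-valid : ∀ {n k′ m l} → OddTypeI n (suc k′) m l →
  ShuffleInput (suc k′) m (proj₁ (durfeeBlocksI (suc k′) m l)) × PartsBelow m (proj₂ (durfeeBlocksI (suc k′) m l))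
durfeeBlocksI-valid {k′ = k′} {m} {l} valid@((lk , _) , _) with durfeeI-splits valid
... | (k≤a , _ , D<k) , (m≤D , m≤X , Γ<m) =
  let a = map ⌊_/2⌋ l; D = drop (suc k′) a; la = halves-sorted lk; lD = sorted-drop (suc k′) la
      lx = Linked.map⁺ (Linked.map (∸-monoˡ-≤ (pred m)) (sorted-take m lD)) in
  (subDurfee≤durfee m≤D m≤X D<k ,
   Linked.map⁺ (Linked.map (∸-monoˡ-≤ (suc k′)) (sorted-take (suc k′) la)) ,
   trans (length-map _ (take (suc k′) a)) (length-take-≤ a k≤a) ,
   ≥-cons (All.map⁺ (All.map (below-Durfee m) (All.take⁺ m D<k))) lx ,
   trans (length-map _ (take m D)) (length-take-≤ D m≤D)) ,
  sorted-drop m lD , Γ<m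
  where
  below-Durfee : ∀ m {y} → y < suc k′ → y ∸ pred m ≤ suc k′ ∸ m
  below-Durfee zero y<k = <⇒≤ y<k
  below-Durfee (suc m′) (s≤s y≤k′) = ∸-monoˡ-≤ m′ y≤k′

oddPartsI∘durfeeBlocksI : ∀ {n k′ m l} → OddTypeI n (suc k′) m l → oddPartsI (suc k′) m (durfeeBlocksI (suc k′) m l) ≡ l
oddPartsI∘durfeeBlocksI {k′ = k′} {m} {l} valid@((_ , odds , _) , _) with durfeeI-splits valid
... | (_ , k≤R , _) , (_ , m≤X , _) = let k = suc k′; a = map ⌊_/2⌋ l; D = drop k a in begin
  map odd (map (_+ k) (map (_∸ k) (take k a)) ++ map (_+ pred m) (map (_∸ pred m) (take m D)) ++ drop m D)
    ≡⟨ cong₂ (λ R X → map odd (R ++ X ++ drop m D)) (map-+∸ k k≤R) (map-+∸ (pred m) m≤X) ⟩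
  map odd (take k a ++ take m D ++ drop m D)
    ≡⟨ cong (λ D′ → map odd (take k a ++ D′)) (take++drop≡id m D) ⟩
  map odd (take k a ++ D)
    ≡⟨ cong (map odd) (take++drop≡id k a) ⟩
  map odd a
    ≡⟨ map-odd-⌊/2⌋ odds ⟩
  l ∎

oddStageI : ∀ {n k′ m} →
  SubsetInverse (OddTypeI n (suc k′) m) (Weighted (ShuffleInput (suc k′) m) (PartsBelow m) (weight (suc k′ ∸ m) m m) n)
oddStageI {n} {k′} {m} = record
  { to      = durfeeBlocksI (suc k′) m
  ; from    = oddPartsI (suc k′) m
  ; to-∈    = λ {l} valid@((_ , _ , l≡n) , _) →
                let (input , pΓ) = durfeeBlocksI-valid valid; ((r , x) , Γ) = durfeeBlocksI (suc k′) m l in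
                input , pΓ , (begin
                  weight (suc k′ ∸ m) m m (sum r + sum x) Γ    ≡⟨ sym (oddPartsI-weight Γ input) ⟩
                  sum (oddPartsI (suc k′) m ((r , x) , Γ))      ≡⟨ cong sum (oddPartsI∘durfeeBlocksI valid) ⟩
                  sum l                                          ≡⟨ l≡n ⟩
                  n ∎)
  ; from-∈  = λ { {(r , x) , Γ} (input , pΓ , w≡n) →
                  let ((lk , odds , _) , durfee , typeI , subDurfee) = oddPartsI-valid input pΓ in
                  (lk , odds , trans (oddPartsI-weight Γ input) w≡n) , durfee , typeI , subDurfee }
  ; from∘to = oddPartsI∘durfeeBlocksI
  ; to∘from = λ { {(r , x) , Γ} ((_ , _ , r≡k , _ , x≡m) , _) → durfeeBlocksI∘oddPartsI (suc k′) m r x Γ r≡k x≡m }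
  }

-- Type II

weight-typeII : ∀ j m sr sx Γ → let K = j + m; A = sr + K * K + (K + (sx + m * m + sum Γ)) in
  weight j (suc m) m (sr + sx) Γ ≡ A + A + (K + suc (m + length Γ))
weight-typeII j m sr sx Γ = +-cancelʳ-≡ (K + m) _ _ (begin
  triangle (j + j + (suc m + m)) + (j + j) + triangle (suc m + m) + (suc m + m) + (s + s) + (g + g) + l + (K + m)
    ≡⟨ cong (λ t → triangle t + (j + j) + triangle (suc m + m) + (suc m + m) + (s + s) + (g + g) + l + (K + m))
            (solve 2 (λ j m → j :+ j :+ (con 1 :+ m :+ m) := con 1 :+ (j :+ m :+ (j :+ m))) refl j m) ⟩
  (K + K) + triangle (K + K) + (j + j) + ((m + m) + triangle (m + m)) + suc (m + m) + (s + s) + (g + g) + l + (K + m)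
    ≡⟨ solve 8 (λ T U j m s g l K → K :+ K :+ T :+ (j :+ j) :+ (m :+ m :+ U) :+ (con 1 :+ (m :+ m)) :+ (s :+ s) :+ (g :+ g) :+ l :+ (K :+ m)
                                   := (T :+ K) :+ (U :+ m) :+ (K :+ K :+ (j :+ j) :+ (m :+ m) :+ (con 1 :+ (m :+ m)) :+ (s :+ s) :+ (g :+ g) :+ l))
            refl (triangle (K + K)) (triangle (m + m)) j m s g l K ⟩
  (triangle (K + K) + K) + (triangle (m + m) + m) + rest
    ≡⟨ cong₂ (λ a b → a + b + rest) (triangle-double K) (triangle-double m) ⟩
  (K * K + K * K) + (m * m + m * m) + rest
    ≡⟨ solve 6 (λ j m sr sx g l → ((j :+ m) :* (j :+ m) :+ (j :+ m) :* (j :+ m)) :+ (m :* m :+ m :* m)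
                                   :+ ((j :+ m) :+ (j :+ m) :+ (j :+ j) :+ (m :+ m) :+ (con 1 :+ (m :+ m)) :+ ((sr :+ sx) :+ (sr :+ sx)) :+ (g :+ g) :+ l)
                                 := (sr :+ (j :+ m) :* (j :+ m) :+ ((j :+ m) :+ (sx :+ m :* m :+ g))) :+ (sr :+ (j :+ m) :* (j :+ m) :+ ((j :+ m) :+ (sx :+ m :* m :+ g)))
                                   :+ ((j :+ m) :+ (con 1 :+ (m :+ l))) :+ ((j :+ m) :+ m))
            refl j m sr sx g l ⟩
  A + A + (K + suc (m + l)) + (K + m) ∎)
  where
  K = j + m
  s = sr + sx
  g = sum Γ
  l = length Γ
  A = sr + K * K + (K + (sx + m * m + g))
  rest = (K + K) + (j + j) + (m + m) + suc (m + m) + (s + s) + (g + g) + l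

-- Halves: the K rows r + K, the diagonal row K, the m rows x + m through the m × (m + 1)
-- rectangle, then Γ.
oddPartsII : ℕ → ℕ → (List ℕ × List ℕ) × List ℕ → List ℕ
oddPartsII K m ((r , x) , Γ) = map odd (map (_+ K) r ++ K ∷ map (_+ m) x ++ Γ)

durfeeBlocksII : ℕ → ℕ → List ℕ → (List ℕ × List ℕ) × List ℕ
durfeeBlocksII K m l = (map (_∸ K) (take K a) , map (_∸ m) (take m D)) , drop m D
  where
  a = map ⌊_/2⌋ l
  D = drop (suc K) a

OddTypeII : ℕ → ℕ → ℕ → List ℕ → Set
OddTypeII n k m l = IsOddPartition n l × IsDur2 l k × TypeII l k × IsSubDurII l k m

sum-oddPartsII : ∀ K m r x Γ → length r ≡ K → length x ≡ m → let A = sum r + K * K + (K + (sum x + m * m + sum Γ)) in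
  sum (oddPartsII K m ((r , x) , Γ)) ≡ A + A + (K + suc (m + length Γ))
sum-oddPartsII K m r x Γ r≡K x≡m =
  trans (sum-map-odd (map (_+ K) r ++ K ∷ map (_+ m) x ++ Γ)) (cong₂ (λ s n → s + s + n) sum-L length-L)
  where
  sum-L : sum (map (_+ K) r ++ K ∷ map (_+ m) x ++ Γ) ≡ sum r + K * K + (K + (sum x + m * m + sum Γ))
  sum-L = begin
    sum (map (_+ K) r ++ K ∷ map (_+ m) x ++ Γ)
      ≡⟨ trans (sum-++ (map (_+ K) r) _) (cong (λ s → sum (map (_+ K) r) + (K + s)) (sum-++ (map (_+ m) x) Γ)) ⟩
    sum (map (_+ K) r) + (K + (sum (map (_+ m) x) + sum Γ))
      ≡⟨ cong₂ (λ a b → a + (K + (b + sum Γ))) (trans (sum-map-+ K r) (cong (λ n → sum r + n * K) r≡K)) (trans (sum-map-+ m x) (cong (λ n → sum x + n * m) x≡m)) ⟩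
    sum r + K * K + (K + (sum x + m * m + sum Γ)) ∎
  length-L : length (map (_+ K) r ++ K ∷ map (_+ m) x ++ Γ) ≡ K + suc (m + length Γ)
  length-L = trans (length-++ (map (_+ K) r)) (cong₂ _+_ (trans (length-map (_+ K) r) r≡K)
               (cong suc (trans (length-++ (map (_+ m) x)) (cong (_+ length Γ) (trans (length-map (_+ m) x) x≡m)))))

oddPartsII-weight : ∀ {K m r x} Γ → ShuffleInput K m (r , x) → sum (oddPartsII K m ((r , x) , Γ)) ≡ weight (K ∸ m) (suc m) m (sum r + sum x) Γ
oddPartsII-weight {K} {m} {r} {x} Γ (m≤K , _ , r≡K , _ , x≡m) = begin
  sum (oddPartsII K m ((r , x) , Γ))         ≡⟨ sum-oddPartsII K m r x Γ r≡K x≡m ⟩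
  A K + A K + (K + suc (m + length Γ))       ≡⟨ cong (λ K → A K + A K + (K + suc (m + length Γ))) (sym (m∸n+n≡m m≤K)) ⟩
  A (K ∸ m + m) + A (K ∸ m + m) + (K ∸ m + m + suc (m + length Γ)) ≡⟨ sym (weight-typeII (K ∸ m) m (sum r) (sum x) Γ) ⟩
  weight (K ∸ m) (suc m) m (sum r + sum x) Γ ∎
  where A = λ K → sum r + K * K + (K + (sum x + m * m + sum Γ))

oddPartsII-valid : ∀ {K m r x Γ} → ShuffleInput K m (r , x) → PartsBelow (suc m) Γ →
  let l = oddPartsII K m ((r , x) , Γ) in IsOddPartition (sum l) l × IsDur2 l (suc K) × TypeII l (suc K) × IsSubDurII l (suc K) m
oddPartsII-valid {K} {m} {r} {x} {Γ} (m≤K , lr , r≡K , jx , x≡m) (lΓ , Γ≤m) =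
  odd-partition sorted , proj₁ durfee , proj₂ durfee , subst (λ L → IsSubDurII (map odd L) (suc K) m) (++-assoc R (K ∷ X) Γ) subDurfee
  where
  R = map (_+ K) r
  X = map (_+ m) x
  R≡K = trans (length-map (_+ K) r) r≡K
  X≡m = trans (length-map (_+ m) x) x≡m
  X≤K : All (_≤ K) X
  X≤K = All.map⁺ (All.map (λ {y} y≤ → subst (y + m ≤_) (m∸n+n≡m m≤K) (+-monoˡ-≤ m y≤)) (≥-head jx))
  XΓ≤K : All (_≤ K) (X ++ Γ)
  XΓ≤K = All.++⁺ X≤K (All.map (λ y<1+m → ≤-trans (≤-pred y<1+m) m≤K) Γ≤m)
  sorted : Linked _≥_ (R ++ K ∷ X ++ Γ)
  sorted = sorted-++ R (K ∷ X ++ Γ) (Linked.map⁺ (Linked.map (+-monoˡ-≤ K) lr))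
             (≥-cons XΓ≤K (sorted-++ X Γ (Linked.map⁺ (Linked.map (+-monoˡ-≤ m) (Linked.tail jx))) lΓ (map-+-lower m x) (All.map ≤-pred Γ≤m)))
             (map-+-lower K r) (≤-refl ∷ XΓ≤K)
  durfee = durfeeII-of-split R (X ++ Γ) R≡K (map-+-lower K r) XΓ≤K
  subDurfee : IsSubDurII (map odd ((R ++ K ∷ X) ++ Γ)) (suc K) m
  subDurfee = subDurfeeII-of-split (R ++ K ∷ X) Γ (trans (length-++ R) (trans (cong₂ (λ a b → a + suc b) R≡K X≡m) (+-suc K m)))
    (All.++⁺ (All.map (λ K≤y → ≤-trans m≤K K≤y) (map-+-lower K r)) (m≤K ∷ map-+-lower m x)) Γ≤m

durfeeBlocksII∘oddPartsII : ∀ K m r x Γ → length r ≡ K → length x ≡ m → durfeeBlocksII K m (oddPartsII K m ((r , x) , Γ)) ≡ ((r , x) , Γ)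
durfeeBlocksII∘oddPartsII K m r x Γ r≡K x≡m
  rewrite map-⌊/2⌋-odd (map (_+ K) r ++ K ∷ map (_+ m) x ++ Γ)
        | take-++ (map (_+ K) r) (K ∷ map (_+ m) x ++ Γ) (trans (length-map (_+ K) r) r≡K)
        | drop-++-∷ (map (_+ K) r) K (map (_+ m) x ++ Γ) (trans (length-map (_+ K) r) r≡K)
        | take-++ (map (_+ m) x) Γ (trans (length-map (_+ m) x) x≡m)
        | drop-++ (map (_+ m) x) Γ (trans (length-map (_+ m) x) x≡m)
        | map-∸+ K r | map-∸+ m x = refl

durfeeII-splits : ∀ {n K m l} → OddTypeII n (suc K) m l → let a = map ⌊_/2⌋ l; D = drop (suc K) a in
  (K < length a × lookup0 a K ≡ K) × (m ≤ length D × All (m ≤_) (take m D) × All (_< suc m) (drop m D))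
durfeeII-splits {K = K} {m} {l} ((lk , odds , _) , _ , typeII , sub) =
  split-of-durfeeII {a = map ⌊_/2⌋ l} (subst (λ l → TypeII l (suc K)) eq typeII) ,
  split-of-subDurfeeII {suc K} (halves-sorted lk) (subst (λ l → IsSubDurII l (suc K) m) eq sub)
  where eq = sym (map-odd-⌊/2⌋ odds)

subDurfee≤durfeeII : ∀ {K m D} → m ≤ length D → All (m ≤_) (take m D) → All (_≤ K) D → m ≤ K
subDurfee≤durfeeII {m = zero} _ _ _ = z≤n
subDurfee≤durfeeII {m = suc m′} {y ∷ D} _ (m≤y ∷ _) (y≤K ∷ _) = ≤-trans m≤y y≤K

durfeeBlocksII-valid : ∀ {n K m l} → OddTypeII n (suc K) m l →
  ShuffleInput K m (proj₁ (durfeeBlocksII K m l)) × PartsBelow (suc m) (proj₂ (durfeeBlocksII K m l))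
durfeeBlocksII-valid {K = K} {m} {l} valid@((lk , _) , _) with durfeeII-splits valid
... | (K<a , aK≡K) , (m≤D , m≤X , Γ≤m) =
  let a = map ⌊_/2⌋ l; D = drop (suc K) a; la = halves-sorted lk
      KD-sorted = subst (Linked _≥_) (trans (drop-lookup a K<a) (cong (_∷ D) aK≡K)) (sorted-drop K la)
      D≤K = ≥-head KD-sorted; lD = Linked.tail KD-sorted
      lx = Linked.map⁺ (Linked.map (∸-monoˡ-≤ m) (sorted-take m lD)) in
  (subDurfee≤durfeeII m≤D m≤X D≤K ,
   Linked.map⁺ (Linked.map (∸-monoˡ-≤ K) (sorted-take K la)) ,
   trans (length-map _ (take K a)) (length-take-≤ a (<⇒≤ K<a)) ,
   ≥-cons (All.map⁺ (All.map (∸-monoˡ-≤ m) (All.take⁺ m D≤K))) lx ,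
   trans (length-map _ (take m D)) (length-take-≤ D m≤D)) ,
  sorted-drop m lD , Γ≤m

oddPartsII∘durfeeBlocksII : ∀ {n K m l} → OddTypeII n (suc K) m l → oddPartsII K m (durfeeBlocksII K m l) ≡ l
oddPartsII∘durfeeBlocksII {K = K} {m} {l} valid@((lk , odds , _) , _) with durfeeII-splits valid
... | (K<a , aK≡K) , (_ , m≤X , _) = let a = map ⌊_/2⌋ l; D = drop (suc K) a in begin
  map odd (map (_+ K) (map (_∸ K) (take K a)) ++ K ∷ map (_+ m) (map (_∸ m) (take m D)) ++ drop m D)
    ≡⟨ cong₂ (λ R X → map odd (R ++ K ∷ X ++ drop m D))
             (map-+∸ K (sorted-take-lower′ K (halves-sorted lk) (≤-reflexive (sym aK≡K)) K<a)) (map-+∸ m m≤X) ⟩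
  map odd (take K a ++ K ∷ take m D ++ drop m D)
    ≡⟨ cong (λ D′ → map odd (take K a ++ K ∷ D′)) (take++drop≡id m D) ⟩
  map odd (take K a ++ K ∷ D)
    ≡⟨ cong (λ D′ → map odd (take K a ++ D′)) (sym (trans (drop-lookup a K<a) (cong (_∷ D) aK≡K))) ⟩
  map odd (take K a ++ drop K a)
    ≡⟨ cong (map odd) (take++drop≡id K a) ⟩
  map odd a
    ≡⟨ map-odd-⌊/2⌋ odds ⟩
  l ∎

oddStageII : ∀ {n K m} →
  SubsetInverse (OddTypeII n (suc K) m) (Weighted (ShuffleInput K m) (PartsBelow (suc m)) (weight (K ∸ m) (suc m) m) n)
oddStageII {n} {K} {m} = record
  { to      = durfeeBlocksII K m
  ; from    = oddPartsII K m
  ; to-∈    = λ {l} valid@((_ , _ , l≡n) , _) →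
                let (input , pΓ) = durfeeBlocksII-valid valid; ((r , x) , Γ) = durfeeBlocksII K m l in
                input , pΓ , (begin
                  weight (K ∸ m) (suc m) m (sum r + sum x) Γ   ≡⟨ sym (oddPartsII-weight Γ input) ⟩
                  sum (oddPartsII K m ((r , x) , Γ))            ≡⟨ cong sum (oddPartsII∘durfeeBlocksII valid) ⟩
                  sum l                                          ≡⟨ l≡n ⟩
                  n ∎)
  ; from-∈  = λ { {(r , x) , Γ} (input , pΓ , w≡n) →
                  let ((lk , odds , _) , durfee , typeII , subDurfee) = oddPartsII-valid input pΓ in
                  (lk , odds , trans (oddPartsII-weight Γ input) w≡n) , durfee , typeII , subDurfee }
  ; from∘to = oddPartsII∘durfeeBlocksII
  ; to∘from = λ { {(r , x) , Γ} ((_ , _ , r≡K , _ , x≡m) , _) → durfeeBlocksII∘oddPartsII K m r x Γ r≡K x≡m }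
  }

theorem1p2 : (n k m : ℕ) → 1 ≤ k → k ≤ n →
    Inverse (A1Setoid n k m) (DSetoid n (2 * k) (2 * m))
    × Inverse (A2Setoid n k m) (DSetoid n (2 * k ∸ 1) (2 * m + 1))
theorem1p2 n (suc K) m _ _ = typeI , typeII
  where
  open SubsetInverse using (inverse)
  typeI : Inverse (A1Setoid n (suc K) m) (DSetoid n (2 * suc K) (2 * m))
  typeI = inverse oddStageI
        ⨾ (inverse (shuffleStage (PartsBelow m) (weight (suc K ∸ m) m m))
        ⨾ inverse (distinctStage ≤-refl (n≤1+n m) (solve 1 (λ m → m :+ m := con 2 :* m) refl m)
                    (trans (cong (suc K + suc K +_) (n∸n≡0 m)) (solve 1 (λ k → k :+ k :+ con 0 := con 2 :* k) refl (suc K)))))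
  typeII : Inverse (A2Setoid n (suc K) m) (DSetoid n (2 * suc K ∸ 1) (2 * m + 1))
  typeII = inverse oddStageII
         ⨾ (inverse (shuffleStage (PartsBelow (suc m)) (weight (K ∸ m) (suc m) m))
         ⨾ inverse (distinctStage (n≤1+n m) ≤-refl (sym (2*+1≡odd m))
                     (trans (cong (K + K +_) (m+n∸n≡m 1 m)) (trans (+-comm (K + K) 1) (sym (2*suc∸1≡odd K))))))
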